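{- There is a universal constant $c>0$ such that the following holds. Let $f\colon\mathbb{F}_2^n\to\mathbb{F}_2$ be an affine extractor for dimension $k$ with bias $\varepsilon$. Then for any polynomial $g\colon\mathbb{F}_2^n\to\mathbb{F}_2$ of degree $d$ such that $k\le c\cdot n^{1/(d-1)!}$, it holds that \[ \mathrm{Cor}(f,g):=\mathbb{E}_{x\sim\mathbb{F}_2^n}\big[(-1)^{f(x)}(-1)^{g(x)}\big]\le\varepsilon. \]
   Context: Here $x$ is uniform on $\mathbb{F}_2^n$. A function $f\colon\mathbb{F}_2^n\to\mathbb{F}_2$ is an affine extractor for dimension $k$ with bias $\varepsilon$ if for every affine subspace $u_0+U$ of dimension $k$, $\big|\mathbb{E}_{x\sim u_0+U}[(-1)^{f(x)}]\big|\le\varepsilon$.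
   Formalization: The bias ε ranges over ℚ, and the universal constant c is taken in ℚ. -}

module Defs where

open import Data.Bool using (Bool; true; false; if_then_else_; _xor_; _∧_)
open import Data.Nat as ℕ using (ℕ; zero; suc; _∸_; _!)
open import Data.Nat.Properties using (m^n≢0)
open import Data.Integer as ℤ using (ℤ)
open import Data.Rational as ℚ using (ℚ; _/_)
open import Data.List using (List; []; _∷_; map; _++_; foldr)
open import Data.Vec using (Vec; []; _∷_; replicate; zipWith)
open import Relation.Binary.PropositionalEquality using (_≡_)
open import Data.Product using (Σ; _×_)

-- Points of F₂ⁿ: Bool is F₂ (xor = +, ∧ = ·).
F₂^ : ℕ → Set
F₂^ n = Vec Bool n

cube : (n : ℕ) → List (F₂^ n)
cube zero = [] ∷ []
cube (suc n) = map (false ∷_) (cube n) ++ map (true ∷_) (cube n)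

_⊕_ : ∀ {n} → F₂^ n → F₂^ n → F₂^ n
_⊕_ = zipWith _xor_

𝟎 : ∀ {n} → F₂^ n
𝟎 = replicate _ false

sign : Bool → ℤ
sign false = ℤ.+ 1
sign true  = ℤ.-[1+ 0 ]

sumℤ : List ℤ → ℤ
sumℤ = foldr ℤ._+_ (ℤ.+ 0)

comb : ∀ {n k} → Vec (F₂^ n) k → F₂^ k → F₂^ n
comb []       []       = 𝟎
comb (v ∷ vs) (a ∷ as) = if a then v ⊕ comb vs as else comb vs as

LinIndep : ∀ {n k} → Vec (F₂^ n) k → Set
LinIndep {k = k} vs = ∀ (a : F₂^ k) → comb vs a ≡ 𝟎 → a ≡ 𝟎

-- E_{x ∼ u₀ + span(vs)} [(-1)^{f(x)}]; for linearly independent vs the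
-- map a ↦ u₀ + Σ aᵢ vᵢ is a bijection F₂ᵏ → u₀ + U, so this is the uniform
-- average over the k-dimensional affine subspace u₀ + U.
affineBias : ∀ {n k} → (F₂^ n → Bool) → F₂^ n → Vec (F₂^ n) k → ℚ
affineBias {k = k} f u₀ vs =
  _/_ (sumℤ (map (λ a → sign (f (u₀ ⊕ comb vs a))) (cube k))) (2 ℕ.^ k)
    {{m^n≢0 2 k}}

IsAffineExtractor : (n k : ℕ) → (F₂^ n → Bool) → ℚ → Set
IsAffineExtractor n k f ε =
  ∀ (u₀ : F₂^ n) (vs : Vec (F₂^ n) k) → LinIndep vs →
    ℚ.∣ affineBias f u₀ vs ∣ ℚ.≤ ε

-- monomial x^S = ∏_{i ∈ S} xᵢ, with S ⊆ [n] given as its indicator vector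
monomial : ∀ {n} → F₂^ n → F₂^ n → Bool
monomial []            []       = true
monomial (false ∷ S)   (_ ∷ x)  = monomial S x
monomial (true ∷ S)    (b ∷ x)  = b ∧ monomial S x

size : ∀ {n} → F₂^ n → ℕ
size []          = 0
size (false ∷ S) = size S
size (true ∷ S)  = suc (size S)

xorList : List Bool → Bool
xorList = foldr _xor_ false

-- the function F₂ⁿ → F₂ computed by the multilinear polynomial with
-- coefficients coef : 2^[n] → F₂, i.e. x ↦ Σ_S coef(S) x^S
evalPoly : ∀ {n} → (F₂^ n → Bool) → F₂^ n → Bool
evalPoly {n} coef x = xorList (map (λ S → coef S ∧ monomial S x) (cube n))

HasDegree≤ : (n d : ℕ) → (F₂^ n → Bool) → Set
HasDegree≤ n d g =
  Σ (F₂^ n → Bool) (λ coef →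
     (∀ S → coef S ≡ true → size S ℕ.≤ d) × (∀ x → g x ≡ evalPoly coef x))

Cor : ∀ {n} → (F₂^ n → Bool) → (F₂^ n → Bool) → ℚ
Cor {n} f g =
  _/_ (sumℤ (map (λ x → sign (f x) ℤ.* sign (g x)) (cube n))) (2 ℕ.^ n)
    {{m^n≢0 2 n}}

_^ℚ_ : ℚ → ℕ → ℚ
q ^ℚ zero  = ℚ.1ℚ
q ^ℚ suc m = q ℚ.* (q ^ℚ m)

-- k ≤ c · n^{1/(d-1)!}, written equivalently (k, c ≥ 0) as
-- k^{(d-1)!} ≤ c^{(d-1)!} · n
Bound : ℚ → (k n d : ℕ) → Set
Bound c k n d = ((ℤ.+ k / 1) ^ℚ ((d ∸ 1) !)) ℚ.≤ (c ^ℚ ((d ∸ 1) !)) ℚ.* (ℤ.+ n / 1)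

-- Over F₂ a polynomial g of degree ≤ e + 1 has constant (e+1)-th derivatives, and for every
-- e-tuple a the map v ↦ ∂_a ∂_v g is linear. Choosing vectors greedily in the common kernel of
-- these functionals for all e-tuples of earlier choices yields m independent directions, as long
-- as n ≥ m + mᵉ, along which all (e+1)-th derivatives vanish: g has degree ≤ e on every coset of
-- their span. An affine extractor restricts to an affine extractor on each coset, so Cor(f, g) is
-- an average of correlations with polynomials of lower degree. The recursion ends with g constant
-- on cosets of dimension k, where the bias bound of f applies directly. The dimension needed grows
-- like (8k)^((d-1)!), which is the hypothesis k ≤ c · n^(1/(d-1)!) for c = 1/8.

module Submission where

open import Defs
open import Algebra.Bundles using (CommutativeRing)
import Algebra.Properties.CommutativeSemigroup as CommutativeSemigroupProperties
open import Data.Bool using (Bool; true; false; if_then_else_; _xor_; _∧_)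
open import Data.Bool.Properties as 𝔹
  using (xor-assoc; xor-comm; xor-identityʳ; xor-same; xor-∧-commutativeRing)
open import Data.Nat as ℕ using (ℕ; zero; suc; _+_; _*_; _∸_; _^_; _≤_; _<_; _≥_; z≤n; s≤s; _!)
import Data.Nat.Properties as ℕ
open import Data.Nat.Tactic.RingSolver using (solve-∀)
open import Data.Integer as ℤ using (ℤ)
import Data.Integer.Properties as ℤ
open import Data.Rational as ℚ using (ℚ; 0ℚ; _/_)
import Data.Rational.Properties as ℚ
import Data.Rational.Unnormalised as ℚᵘ
import Data.Rational.Unnormalised.Properties as ℚᵘ
open import Data.List as List using (List; []; _∷_; _++_; length; [_])
import Data.List.Properties as List
open import Data.List.Relation.Unary.All as All using (All; []; _∷_)
import Data.List.Relation.Unary.All.Properties as AllP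
open import Data.List.Relation.Unary.Any using (here; there)
open import Data.List.Relation.Unary.Unique.Propositional using (Unique; []; _∷_)
import Data.List.Relation.Unary.Unique.Propositional.Properties as Unique
open import Data.List.Membership.Propositional using (_∈_)
open import Data.List.Membership.Propositional.Properties
  using (∈-++⁺ˡ; ∈-++⁺ʳ; ∈-++⁻; ∈-map⁺; ∈-map⁻; ∈-∃++;
         ∈-cartesianProductWith⁺; ∈-cartesianProductWith⁻)
open import Data.List.Relation.Binary.Permutation.Propositional as Perm
  using (_↭_; refl; prep; swap; ↭-sym; ↭-trans)
import Data.List.Relation.Binary.Permutation.Propositional.Properties as ↭
open import Data.Vec as Vec using (Vec; []; _∷_)
open import Data.Vec.Properties using (length-toList; cast-is-id)
open import Data.Product using (Σ; Σ-syntax; ∃; _×_; _,_; proj₁; proj₂)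
open import Data.Sum using (_⊎_; inj₁; inj₂)
open import Data.Empty using (⊥; ⊥-elim)
open import Function using (_∘_; id)
open import Relation.Binary.PropositionalEquality
  using (_≡_; refl; sym; trans; cong; cong₂; subst; subst₂; module ≡-Reasoning)

-- The threshold dimension

-- A polynomial of degree < d + 2 drops degree on a subspace of dimension m once n ≥ m + mᵈ,
-- so recursing on the degree needs n ≥ threshold d k.
threshold : ℕ → ℕ → ℕ
threshold zero    k = k
threshold (suc e) k = threshold e k + threshold e k ^ e

module _ where
  open ℕ.≤-Reasoning

  [m*n]^o≡m^o*n^o : ∀ m n o → (m * n) ^ o ≡ m ^ o * n ^ o
  [m*n]^o≡m^o*n^o m n zero    = refl
  [m*n]^o≡m^o*n^o m n (suc o) =
    trans (cong ((m * n) *_) ([m*n]^o≡m^o*n^o m n o)) (interchange m n _ _)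
    where
    interchange : ∀ a b c d → (a * b) * (c * d) ≡ (a * c) * (b * d)
    interchange = solve-∀

  k≤threshold : ∀ d k → k ≤ threshold d k
  k≤threshold zero    k = ℕ.≤-refl
  k≤threshold (suc d) k = ℕ.≤-trans (k≤threshold d k) (ℕ.m≤m+n _ _)

  a[k+1]≤2ak : ∀ a k → 1 ≤ k → a * (k + 1) ≤ (a + a) * k
  a[k+1]≤2ak a k 1≤k = begin
    a * (k + 1)      ≡⟨ ℕ.*-distribˡ-+ a k 1 ⟩
    a * k + a * 1    ≤⟨ ℕ.+-monoʳ-≤ (a * k) (ℕ.*-monoʳ-≤ a 1≤k) ⟩
    a * k + a * k    ≡⟨ ℕ.*-distribʳ-+ k a a ⟨
    (a + a) * k      ∎

  m≤m^[1+n] : ∀ m n → 1 ≤ m → m ≤ m ^ suc n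
  m≤m^[1+n] m n 1≤m = begin
    m          ≡⟨ ℕ.*-identityʳ m ⟨
    m * 1      ≡⟨ cong (m *_) (ℕ.^-zeroˡ n) ⟨
    m * 1 ^ n  ≤⟨ ℕ.*-monoʳ-≤ m (ℕ.^-monoˡ-≤ n 1≤m) ⟩
    m ^ suc n  ∎

  2*threshold≤ : ∀ d k → 1 ≤ k → 2 * threshold (suc d) k ≤ (8 * k) ^ (d !)
  2*threshold≤ zero k 1≤k = begin
    2 * (k + 1)  ≤⟨ a[k+1]≤2ak 2 k 1≤k ⟩
    4 * k        ≤⟨ ℕ.*-monoˡ-≤ k (ℕ.m≤m+n 4 4) ⟩
    8 * k        ≡⟨ ℕ.*-identityʳ (8 * k) ⟨
    (8 * k) ^ 1  ∎
  2*threshold≤ (suc zero) k 1≤k = begin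
    2 * ((k + 1) + (k + 1) * 1)  ≡⟨ 2[x+x*1]≡4x (k + 1) ⟩
    4 * (k + 1)                  ≤⟨ a[k+1]≤2ak 4 k 1≤k ⟩
    8 * k                        ≡⟨ ℕ.*-identityʳ (8 * k) ⟨
    (8 * k) ^ 1                  ∎
    where
    2[x+x*1]≡4x : ∀ x → 2 * (x + x * 1) ≡ 4 * x
    2[x+x*1]≡4x = solve-∀
  2*threshold≤ (suc (suc d)) k 1≤k = begin
    2 * (t + t ^ suc (suc d))
      ≤⟨ ℕ.*-monoʳ-≤ 2 (ℕ.+-monoˡ-≤ _ (m≤m^[1+n] t (suc d) 1≤t)) ⟩
    2 * (t ^ suc (suc d) + t ^ suc (suc d))
      ≡⟨ 2[x+x]≡4x (t ^ suc (suc d)) ⟩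
    4 * t ^ suc (suc d)
      ≤⟨ ℕ.*-monoˡ-≤ (t ^ suc (suc d)) (ℕ.^-monoʳ-≤ 2 (s≤s (s≤s (z≤n {d})))) ⟩
    2 ^ suc (suc d) * t ^ suc (suc d)
      ≡⟨ [m*n]^o≡m^o*n^o 2 t (suc (suc d)) ⟨
    (2 * t) ^ suc (suc d)
      ≤⟨ ℕ.^-monoˡ-≤ (suc (suc d)) (2*threshold≤ (suc d) k 1≤k) ⟩
    ((8 * k) ^ (suc d !)) ^ suc (suc d)
      ≡⟨ ℕ.^-*-assoc (8 * k) (suc d !) (suc (suc d)) ⟩
    (8 * k) ^ (suc d ! * suc (suc d))
      ≡⟨ cong ((8 * k) ^_) (ℕ.*-comm (suc d !) (suc (suc d))) ⟩
    (8 * k) ^ (suc (suc d) !) ∎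
    where
    t : ℕ
    t = threshold (suc (suc d)) k
    1≤t : 1 ≤ t
    1≤t = ℕ.≤-trans 1≤k (k≤threshold (suc (suc d)) k)
    2[x+x]≡4x : ∀ x → 2 * (x + x) ≡ 4 * x
    2[x+x]≡4x = solve-∀

  threshold≤ : ∀ d k → 1 ≤ k → threshold (suc d) k ≤ (8 * k) ^ (d !)
  threshold≤ d k 1≤k = ℕ.≤-trans (ℕ.m≤n*m _ 2) (2*threshold≤ d k 1≤k)

open ≡-Reasoning

open CommutativeSemigroupProperties
  (CommutativeRing.+-commutativeSemigroup xor-∧-commutativeRing)
  using () renaming (interchange to xor-interchange)

-- The vector space F₂ⁿ

xor-split : ∀ a b c → a xor c ≡ (a xor b) xor (b xor c)
xor-split a b c = begin
  a xor c                  ≡⟨ cong (a xor_) (cong (_xor c) (xor-same b)) ⟨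
  a xor ((b xor b) xor c)  ≡⟨ cong (a xor_) (xor-assoc b b c) ⟩
  a xor (b xor (b xor c))  ≡⟨ xor-assoc a b (b xor c) ⟨
  (a xor b) xor (b xor c)  ∎

xor≡false⇒≡ : ∀ a b → a xor b ≡ false → a ≡ b
xor≡false⇒≡ false false _ = refl
xor≡false⇒≡ true  true  _ = refl

⊕-assoc : ∀ {n} (x y z : F₂^ n) → (x ⊕ y) ⊕ z ≡ x ⊕ (y ⊕ z)
⊕-assoc []      []      []      = refl
⊕-assoc (a ∷ x) (b ∷ y) (c ∷ z) = cong₂ _∷_ (xor-assoc a b c) (⊕-assoc x y z)

⊕-comm : ∀ {n} (x y : F₂^ n) → x ⊕ y ≡ y ⊕ x
⊕-comm []      []      = refl
⊕-comm (a ∷ x) (b ∷ y) = cong₂ _∷_ (xor-comm a b) (⊕-comm x y)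

⊕-identityˡ : ∀ {n} (x : F₂^ n) → 𝟎 ⊕ x ≡ x
⊕-identityˡ []      = refl
⊕-identityˡ (a ∷ x) = cong (a ∷_) (⊕-identityˡ x)

⊕-identityʳ : ∀ {n} (x : F₂^ n) → x ⊕ 𝟎 ≡ x
⊕-identityʳ x = trans (⊕-comm x 𝟎) (⊕-identityˡ x)

⊕-same : ∀ {n} (x : F₂^ n) → x ⊕ x ≡ 𝟎
⊕-same []      = refl
⊕-same (a ∷ x) = cong₂ _∷_ (xor-same a) (⊕-same x)

⊕-interchange : ∀ {n} (w x y z : F₂^ n) → (w ⊕ x) ⊕ (y ⊕ z) ≡ (w ⊕ y) ⊕ (x ⊕ z)
⊕-interchange []      []      []      []      = refl
⊕-interchange (a ∷ w) (b ∷ x) (c ∷ y) (d ∷ z) =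
  cong₂ _∷_ (xor-interchange a b c d) (⊕-interchange w x y z)

x⊕y⊕y≡x : ∀ {n} (x y : F₂^ n) → (x ⊕ y) ⊕ y ≡ x
x⊕y⊕y≡x x y = trans (⊕-assoc x y y) (trans (cong (x ⊕_) (⊕-same y)) (⊕-identityʳ x))

x⊕y⊕z≡x⊕z⊕y : ∀ {n} (x y z : F₂^ n) → (x ⊕ y) ⊕ z ≡ (x ⊕ z) ⊕ y
x⊕y⊕z≡x⊕z⊕y x y z =
  trans (⊕-assoc x y z) (trans (cong (x ⊕_) (⊕-comm y z)) (sym (⊕-assoc x z y)))

x⊕y≡𝟎⇒x≡y : ∀ {n} (x y : F₂^ n) → x ⊕ y ≡ 𝟎 → x ≡ y
x⊕y≡𝟎⇒x≡y x y eq = begin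
  x            ≡⟨ sym (x⊕y⊕y≡x x y) ⟩
  (x ⊕ y) ⊕ y  ≡⟨ cong (_⊕ y) eq ⟩
  𝟎 ⊕ y        ≡⟨ ⊕-identityˡ y ⟩
  y            ∎

scale : ∀ {n} → Bool → F₂^ n → F₂^ n
scale a v = if a then v else 𝟎

scale-xor : ∀ {n} a b (v : F₂^ n) → scale (a xor b) v ≡ scale a v ⊕ scale b v
scale-xor false b    v = sym (⊕-identityˡ _)
scale-xor true false v = sym (⊕-identityʳ v)
scale-xor true true  v = sym (⊕-same v)

scale-⊕ : ∀ {n} a (x y : F₂^ n) → scale a (x ⊕ y) ≡ scale a x ⊕ scale a y
scale-⊕ true  x y = refl
scale-⊕ false x y = sym (⊕-identityʳ 𝟎)

scale-∧ : ∀ {n} a b (v : F₂^ n) → scale a (scale b v) ≡ scale (a ∧ b) v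
scale-∧ true  b v = refl
scale-∧ false b v = refl

lincomb : ∀ {n} (vs : List (F₂^ n)) → F₂^ (length vs) → F₂^ n
lincomb []       []       = 𝟎
lincomb (v ∷ vs) (a ∷ as) = if a then v ⊕ lincomb vs as else lincomb vs as

lincomb-∷ : ∀ {n} v (vs : List (F₂^ n)) a as →
            lincomb (v ∷ vs) (a ∷ as) ≡ scale a v ⊕ lincomb vs as
lincomb-∷ v vs true  as = refl
lincomb-∷ v vs false as = sym (⊕-identityˡ _)

lincomb-𝟎 : ∀ {n} (vs : List (F₂^ n)) → lincomb vs 𝟎 ≡ 𝟎
lincomb-𝟎 []       = refl
lincomb-𝟎 (v ∷ vs) = lincomb-𝟎 vs

lincomb-⊕ : ∀ {n} (vs : List (F₂^ n)) a b → lincomb vs (a ⊕ b) ≡ lincomb vs a ⊕ lincomb vs b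
lincomb-⊕ []       []       []       = sym (⊕-identityʳ 𝟎)
lincomb-⊕ (v ∷ vs) (a ∷ as) (b ∷ bs) = begin
  lincomb (v ∷ vs) ((a xor b) ∷ (as ⊕ bs))
    ≡⟨ lincomb-∷ v vs _ _ ⟩
  scale (a xor b) v ⊕ lincomb vs (as ⊕ bs)
    ≡⟨ cong₂ _⊕_ (scale-xor a b v) (lincomb-⊕ vs as bs) ⟩
  (scale a v ⊕ scale b v) ⊕ (lincomb vs as ⊕ lincomb vs bs)
    ≡⟨ ⊕-interchange _ _ _ _ ⟩
  (scale a v ⊕ lincomb vs as) ⊕ (scale b v ⊕ lincomb vs bs)
    ≡⟨ sym (cong₂ _⊕_ (lincomb-∷ v vs a as) (lincomb-∷ v vs b bs)) ⟩
  lincomb (v ∷ vs) (a ∷ as) ⊕ lincomb (v ∷ vs) (b ∷ bs) ∎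

comb-map : ∀ {m n k} (L : F₂^ m → F₂^ n) →
           (∀ x y → L (x ⊕ y) ≡ L x ⊕ L y) → L 𝟎 ≡ 𝟎 →
           (vs : Vec (F₂^ m) k) (a : F₂^ k) → comb (Vec.map L vs) a ≡ L (comb vs a)
comb-map L L-⊕ L-𝟎 []       []          = sym L-𝟎
comb-map L L-⊕ L-𝟎 (v ∷ vs) (true ∷ a)  =
  trans (cong (L v ⊕_) (comb-map L L-⊕ L-𝟎 vs a)) (sym (L-⊕ v _))
comb-map L L-⊕ L-𝟎 (v ∷ vs) (false ∷ a) = comb-map L L-⊕ L-𝟎 vs a

Independent : ∀ {n} → List (F₂^ n) → Set
Independent vs = ∀ a → lincomb vs a ≡ 𝟎 → a ≡ 𝟎

lincomb-injective : ∀ {n} (vs : List (F₂^ n)) → Independent vs →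
                    ∀ a b → lincomb vs a ≡ lincomb vs b → a ≡ b
lincomb-injective vs ind a b eq = x⊕y≡𝟎⇒x≡y a b (ind (a ⊕ b) (begin
  lincomb vs (a ⊕ b)               ≡⟨ lincomb-⊕ vs a b ⟩
  lincomb vs a ⊕ lincomb vs b      ≡⟨ cong (_⊕ lincomb vs b) eq ⟩
  lincomb vs b ⊕ lincomb vs b      ≡⟨ ⊕-same _ ⟩
  𝟎                                ∎))

-- Discrete derivatives

∂ : ∀ {n} → F₂^ n → (F₂^ n → Bool) → F₂^ n → Bool
∂ v h y = h (y ⊕ v) xor h y

∂⋆ : ∀ {n} → List (F₂^ n) → (F₂^ n → Bool) → F₂^ n → Bool
∂⋆ []       h = h
∂⋆ (v ∷ vs) h = ∂⋆ vs (∂ v h)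

DegreeBelow : ∀ {n} → ℕ → (F₂^ n → Bool) → Set
DegreeBelow {n} p h = ∀ (vs : List (F₂^ n)) → length vs ≡ p → ∀ x → ∂⋆ vs h x ≡ false

∂⋆-cong : ∀ {n} (vs : List (F₂^ n)) {h h′ : F₂^ n → Bool} →
          (∀ y → h y ≡ h′ y) → ∀ x → ∂⋆ vs h x ≡ ∂⋆ vs h′ x
∂⋆-cong []       eq x = eq x
∂⋆-cong (v ∷ vs) eq x = ∂⋆-cong vs (λ y → cong₂ _xor_ (eq (y ⊕ v)) (eq y)) x

∂⋆-xor : ∀ {n} (vs : List (F₂^ n)) (h₁ h₂ : F₂^ n → Bool) x →
         ∂⋆ vs (λ y → h₁ y xor h₂ y) x ≡ ∂⋆ vs h₁ x xor ∂⋆ vs h₂ x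
∂⋆-xor []       h₁ h₂ x = refl
∂⋆-xor (v ∷ vs) h₁ h₂ x = trans
  (∂⋆-cong vs (λ y → xor-interchange (h₁ (y ⊕ v)) (h₂ (y ⊕ v)) (h₁ y) (h₂ y)) x)
  (∂⋆-xor vs (∂ v h₁) (∂ v h₂) x)

∂⋆-false : ∀ {n} (vs : List (F₂^ n)) (h : F₂^ n → Bool) → (∀ y → h y ≡ false) →
           ∀ x → ∂⋆ vs h x ≡ false
∂⋆-false []       h h≡false x = h≡false x
∂⋆-false (v ∷ vs) h h≡false x =
  ∂⋆-false vs (∂ v h) (λ y → cong₂ _xor_ (h≡false (y ⊕ v)) (h≡false y)) x

∂⋆-shift : ∀ {n} (vs : List (F₂^ n)) (h : F₂^ n → Bool) u x →
           ∂⋆ vs (λ y → h (y ⊕ u)) x ≡ ∂⋆ vs h (x ⊕ u)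
∂⋆-shift []       h u x = refl
∂⋆-shift (v ∷ vs) h u x = trans
  (∂⋆-cong vs (λ y → cong (λ z → h z xor h (y ⊕ u)) (x⊕y⊕z≡x⊕z⊕y y v u)) x)
  (∂⋆-shift vs (∂ v h) u x)

∂⋆-∂ : ∀ {n} (vs : List (F₂^ n)) (h : F₂^ n → Bool) u x →
       ∂⋆ vs (∂ u h) x ≡ ∂ u (∂⋆ vs h) x
∂⋆-∂ vs h u x =
  trans (∂⋆-xor vs (λ y → h (y ⊕ u)) h x) (cong (_xor ∂⋆ vs h x) (∂⋆-shift vs h u x))

∂⋆-++ : ∀ {n} (vs ws : List (F₂^ n)) h x → ∂⋆ (vs ++ ws) h x ≡ ∂⋆ ws (∂⋆ vs h) x
∂⋆-++ []       ws h x = refl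
∂⋆-++ (v ∷ vs) ws h x = ∂⋆-++ vs ws (∂ v h) x

∂-comm : ∀ {n} (u v : F₂^ n) h y → ∂ u (∂ v h) y ≡ ∂ v (∂ u h) y
∂-comm u v h y = begin
  (h ((y ⊕ u) ⊕ v) xor h (y ⊕ u)) xor (h (y ⊕ v) xor h y)
    ≡⟨ xor-interchange (h ((y ⊕ u) ⊕ v)) (h (y ⊕ u)) (h (y ⊕ v)) (h y) ⟩
  (h ((y ⊕ u) ⊕ v) xor h (y ⊕ v)) xor (h (y ⊕ u) xor h y)
    ≡⟨ cong (λ z → (h z xor h (y ⊕ v)) xor (h (y ⊕ u) xor h y)) (x⊕y⊕z≡x⊕z⊕y y u v) ⟩
  (h ((y ⊕ v) ⊕ u) xor h (y ⊕ v)) xor (h (y ⊕ u) xor h y) ∎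

∂⋆-↭ : ∀ {n} {vs ws : List (F₂^ n)} → vs ↭ ws → ∀ h x → ∂⋆ vs h x ≡ ∂⋆ ws h x
∂⋆-↭ refl       h x = refl
∂⋆-↭ (prep v p) h x = ∂⋆-↭ p (∂ v h) x
∂⋆-↭ {ws = _ ∷ _ ∷ ws} (swap u v p) h x =
  trans (∂⋆-↭ p (∂ v (∂ u h)) x) (∂⋆-cong ws (∂-comm v u h) x)
∂⋆-↭ (Perm.trans p q) h x = trans (∂⋆-↭ p h x) (∂⋆-↭ q h x)

∂-𝟎 : ∀ {n} h (y : F₂^ n) → ∂ 𝟎 h y ≡ false
∂-𝟎 h y = trans (cong (λ z → h z xor h y) (⊕-identityʳ y)) (xor-same (h y))

∂-∂-same : ∀ {n} (u : F₂^ n) h y → ∂ u (∂ u h) y ≡ false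
∂-∂-same u h y = begin
  (h ((y ⊕ u) ⊕ u) xor h (y ⊕ u)) xor (h (y ⊕ u) xor h y)
    ≡⟨ cong (λ z → (h z xor h (y ⊕ u)) xor (h (y ⊕ u) xor h y)) (x⊕y⊕y≡x y u) ⟩
  (h y xor h (y ⊕ u)) xor (h (y ⊕ u) xor h y)
    ≡⟨ cong ((h y xor h (y ⊕ u)) xor_) (xor-comm (h (y ⊕ u)) (h y)) ⟩
  (h y xor h (y ⊕ u)) xor (h y xor h (y ⊕ u))
    ≡⟨ xor-same (h y xor h (y ⊕ u)) ⟩
  false ∎

∂-⊕ : ∀ {n} (u v : F₂^ n) h y → ∂ (u ⊕ v) h y ≡ ∂ u h (y ⊕ v) xor ∂ v h y
∂-⊕ u v h y = begin
  h (y ⊕ (u ⊕ v)) xor h y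
    ≡⟨ cong (λ z → h z xor h y) (trans (cong (y ⊕_) (⊕-comm u v)) (sym (⊕-assoc y v u))) ⟩
  h ((y ⊕ v) ⊕ u) xor h y
    ≡⟨ xor-split (h ((y ⊕ v) ⊕ u)) (h (y ⊕ v)) (h y) ⟩
  ∂ u h (y ⊕ v) xor ∂ v h y ∎

∂⋆-∷-⊕ : ∀ {n} (u v : F₂^ n) vs h x →
         ∂⋆ ((u ⊕ v) ∷ vs) h x ≡ ∂⋆ (u ∷ vs) h (x ⊕ v) xor ∂⋆ (v ∷ vs) h x
∂⋆-∷-⊕ u v vs h x = begin
  ∂⋆ vs (∂ (u ⊕ v) h) x
    ≡⟨ ∂⋆-cong vs (∂-⊕ u v h) x ⟩
  ∂⋆ vs (λ y → ∂ u h (y ⊕ v) xor ∂ v h y) x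
    ≡⟨ ∂⋆-xor vs _ (∂ v h) x ⟩
  ∂⋆ vs (λ y → ∂ u h (y ⊕ v)) x xor ∂⋆ vs (∂ v h) x
    ≡⟨ cong (_xor ∂⋆ vs (∂ v h) x) (∂⋆-shift vs (∂ u h) v x) ⟩
  ∂⋆ vs (∂ u h) (x ⊕ v) xor ∂⋆ vs (∂ v h) x ∎

∂⋆-∘ : ∀ {m n} (φ L : F₂^ m → F₂^ n) → (∀ y v → φ (y ⊕ v) ≡ φ y ⊕ L v) →
       ∀ (vs : List (F₂^ m)) (h : F₂^ n → Bool) x →
       ∂⋆ vs (h ∘ φ) x ≡ ∂⋆ (List.map L vs) h (φ x)
∂⋆-∘ φ L φ-affine []       h x = refl
∂⋆-∘ φ L φ-affine (v ∷ vs) h x = trans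
  (∂⋆-cong vs (λ y → cong (λ z → h z xor h (φ y)) (φ-affine y v)) x)
  (∂⋆-∘ φ L φ-affine vs (∂ (L v) h) x)

-- Functions of low degree

DegreeBelow-cong : ∀ {n} p {h h′ : F₂^ n → Bool} → (∀ y → h y ≡ h′ y) →
                   DegreeBelow p h → DegreeBelow p h′
DegreeBelow-cong p eq deg vs len x = trans (sym (∂⋆-cong vs eq x)) (deg vs len x)

DegreeBelow-xor : ∀ {n} p {h₁ h₂ : F₂^ n → Bool} → DegreeBelow p h₁ → DegreeBelow p h₂ →
                  DegreeBelow p (λ y → h₁ y xor h₂ y)
DegreeBelow-xor p deg₁ deg₂ vs len x =
  trans (∂⋆-xor vs _ _ x) (cong₂ _xor_ (deg₁ vs len x) (deg₂ vs len x))

DegreeBelow-false : ∀ {n} p → DegreeBelow {n} p (λ _ → false)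
DegreeBelow-false p vs len = ∂⋆-false vs _ (λ _ → refl)

DegreeBelow-const : ∀ {n} b → DegreeBelow {n} 1 (λ _ → b)
DegreeBelow-const b (v ∷ []) refl x = xor-same b

DegreeBelow-∂ : ∀ {n} p {h : F₂^ n → Bool} → DegreeBelow (suc p) h →
                ∀ v → DegreeBelow p (∂ v h)
DegreeBelow-∂ p deg v vs len = deg (v ∷ vs) (cong suc len)

∂-DegreeBelow : ∀ {n} p {h : F₂^ n → Bool} → (∀ v → DegreeBelow p (∂ v h)) →
                DegreeBelow (suc p) h
∂-DegreeBelow p deg (v ∷ vs) len = deg v vs (ℕ.suc-injective len)

DegreeBelow-suc : ∀ {n} p {h : F₂^ n → Bool} → DegreeBelow p h → DegreeBelow (suc p) h
DegreeBelow-suc p {h} deg (v ∷ vs) len x = trans (∂⋆-∂ vs h v x)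
  (cong₂ _xor_ (deg vs (ℕ.suc-injective len) (x ⊕ v)) (deg vs (ℕ.suc-injective len) x))

DegreeBelow-mono : ∀ {n} {p q} {h : F₂^ n → Bool} → p ≤ q → DegreeBelow p h → DegreeBelow q h
DegreeBelow-mono = go ∘ ℕ.≤⇒≤′
  where
  go : ∀ {n} {p q} {h : F₂^ n → Bool} → p ℕ.≤′ q → DegreeBelow p h → DegreeBelow q h
  go (ℕ.≤′-reflexive refl) deg = deg
  go (ℕ.≤′-step p≤′q)      deg = DegreeBelow-suc _ (go p≤′q deg)

DegreeBelow-∘-affine : ∀ {m n} p (φ L : F₂^ m → F₂^ n) →
                       (∀ y v → φ (y ⊕ v) ≡ φ y ⊕ L v) →
                       ∀ {h} → DegreeBelow p h → DegreeBelow p (h ∘ φ)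
DegreeBelow-∘-affine p φ L φ-affine deg vs len x = trans (∂⋆-∘ φ L φ-affine vs _ x)
  (deg (List.map L vs) (trans (List.length-map L vs) len) (φ x))

∧-∂ : ∀ a′ a b′ b → (a′ ∧ b′) xor (a ∧ b) ≡ ((a′ xor a) ∧ b′) xor (a ∧ (b′ xor b))
∧-∂ false false b′ b = refl
∧-∂ false true  b′ b = trans (cong (_xor b) (sym (xor-same b′))) (xor-assoc b′ b′ b)
∧-∂ true  false b′ b = refl
∧-∂ true  true  b′ b = refl

DegreeBelow-∧ : ∀ {n} p q {h₁ h₂ : F₂^ n → Bool} →
                DegreeBelow (suc p) h₁ → DegreeBelow (suc q) h₂ →
                DegreeBelow (suc (p + q)) (λ y → h₁ y ∧ h₂ y)
DegreeBelow-∧ {n} p q {h₁} {h₂} deg₁ deg₂ = ∂-DegreeBelow (p + q) λ v →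
  DegreeBelow-cong (p + q) (λ y → sym (∧-∂ (h₁ (y ⊕ v)) (h₁ y) (h₂ (y ⊕ v)) (h₂ y)))
    (DegreeBelow-xor (p + q) (left p deg₁ v) (right q deg₂ v))
  where
  left : ∀ p → DegreeBelow (suc p) h₁ →
         ∀ v → DegreeBelow (p + q) (λ y → ∂ v h₁ y ∧ h₂ (y ⊕ v))
  left zero     deg₁ v = DegreeBelow-cong q
    (λ y → cong (_∧ h₂ (y ⊕ v)) (sym (deg₁ [ v ] refl y))) (DegreeBelow-false q)
  left (suc p′) deg₁ v = DegreeBelow-∧ p′ q (DegreeBelow-∂ (suc p′) deg₁ v)
    (DegreeBelow-∘-affine (suc q) (_⊕ v) id (λ y w → x⊕y⊕z≡x⊕z⊕y y w v) deg₂)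
  right : ∀ q → DegreeBelow (suc q) h₂ →
          ∀ v → DegreeBelow (p + q) (λ y → h₁ y ∧ ∂ v h₂ y)
  right zero     deg₂ v = DegreeBelow-cong (p + 0)
    (λ y → trans (sym (𝔹.∧-zeroʳ (h₁ y))) (cong (h₁ y ∧_) (sym (deg₂ [ v ] refl y))))
    (DegreeBelow-false (p + 0))
  right (suc q′) deg₂ v =
    subst (λ r → DegreeBelow r (λ y → h₁ y ∧ ∂ v h₂ y)) (sym (ℕ.+-suc p q′))
          (DegreeBelow-∧ p q′ deg₁ (DegreeBelow-∂ (suc q′) deg₂ v))

DegreeBelow-head : ∀ {n} → DegreeBelow {suc n} 2 Vec.head
DegreeBelow-head = ∂-DegreeBelow 1 λ v → DegreeBelow-cong 1 (∂-head v) (DegreeBelow-const (Vec.head v))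
  where
  ∂-head : ∀ {n} (v : F₂^ (suc n)) y → Vec.head v ≡ ∂ v Vec.head y
  ∂-head (b ∷ v) (a ∷ y) = sym (begin
    (a xor b) xor a  ≡⟨ cong (_xor a) (xor-comm a b) ⟩
    (b xor a) xor a  ≡⟨ xor-assoc b a a ⟩
    b xor (a xor a)  ≡⟨ cong (b xor_) (xor-same a) ⟩
    b xor false      ≡⟨ xor-identityʳ b ⟩
    b                ∎)

DegreeBelow-∘-tail : ∀ {n} p {h : F₂^ n → Bool} → DegreeBelow p h → DegreeBelow p (h ∘ Vec.tail)
DegreeBelow-∘-tail p = DegreeBelow-∘-affine p Vec.tail Vec.tail tail-⊕
  where
  tail-⊕ : ∀ {n} (y v : F₂^ (suc n)) → Vec.tail (y ⊕ v) ≡ Vec.tail y ⊕ Vec.tail v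
  tail-⊕ (_ ∷ _) (_ ∷ _) = refl

DegreeBelow-monomial : ∀ {n} (S : F₂^ n) → DegreeBelow (suc (size S)) (monomial S)
DegreeBelow-monomial []          = DegreeBelow-cong 1 (λ { [] → refl }) (DegreeBelow-const true)
DegreeBelow-monomial (false ∷ S) = DegreeBelow-cong (suc (size S)) (λ { (_ ∷ _) → refl })
  (DegreeBelow-∘-tail (suc (size S)) (DegreeBelow-monomial S))
DegreeBelow-monomial (true ∷ S)  = DegreeBelow-cong (suc (suc (size S))) (λ { (_ ∷ _) → refl })
  (DegreeBelow-∧ 1 (size S) DegreeBelow-head (DegreeBelow-∘-tail (suc (size S)) (DegreeBelow-monomial S)))

HasDegree≤⇒DegreeBelow : ∀ {n d} {g : F₂^ n → Bool} → HasDegree≤ n d g → DegreeBelow (suc d) g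
HasDegree≤⇒DegreeBelow {n} {d} (coef , coef⇒size≤d , g≡poly) =
  DegreeBelow-cong (suc d) (sym ∘ g≡poly) (sum-of-terms (cube n))
  where
  term : ∀ S → DegreeBelow (suc d) (λ x → coef S ∧ monomial S x)
  term S with coef S in eq
  ... | true  = DegreeBelow-mono (s≤s (coef⇒size≤d S eq)) (DegreeBelow-monomial S)
  ... | false = DegreeBelow-false (suc d)
  sum-of-terms : ∀ Ss →
    DegreeBelow (suc d) (λ x → xorList (List.map (λ S → coef S ∧ monomial S x) Ss))
  sum-of-terms []       = DegreeBelow-false (suc d)
  sum-of-terms (S ∷ Ss) = DegreeBelow-xor (suc d) (term S) (sum-of-terms Ss)

-- Sums over F₂ⁿ

∑ : (n : ℕ) → (F₂^ n → ℤ) → ℤ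
∑ n H = sumℤ (List.map H (cube n))

sumℤ-++ : ∀ (xs ys : List ℤ) → sumℤ (xs ++ ys) ≡ sumℤ xs ℤ.+ sumℤ ys
sumℤ-++ []       ys = sym (ℤ.+-identityˡ _)
sumℤ-++ (x ∷ xs) ys = trans (cong (λ s → x ℤ.+ s) (sumℤ-++ xs ys)) (sym (ℤ.+-assoc x _ _))

sumℤ-↭ : ∀ {xs ys : List ℤ} → xs ↭ ys → sumℤ xs ≡ sumℤ ys
sumℤ-↭ refl       = refl
sumℤ-↭ (prep x p) = cong (λ s → x ℤ.+ s) (sumℤ-↭ p)
sumℤ-↭ {x ∷ y ∷ xs} {_ ∷ _ ∷ ys} (swap _ _ p) = begin
  x ℤ.+ (y ℤ.+ sumℤ xs)  ≡⟨ sym (ℤ.+-assoc x y _) ⟩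
  (x ℤ.+ y) ℤ.+ sumℤ xs  ≡⟨ cong₂ ℤ._+_ (ℤ.+-comm x y) (sumℤ-↭ p) ⟩
  (y ℤ.+ x) ℤ.+ sumℤ ys  ≡⟨ ℤ.+-assoc y x _ ⟩
  y ℤ.+ (x ℤ.+ sumℤ ys)  ∎
sumℤ-↭ (Perm.trans p q) = trans (sumℤ-↭ p) (sumℤ-↭ q)

sumℤ-map-* : ∀ {A : Set} (f : A → ℤ) c xs →
             sumℤ (List.map (λ x → f x ℤ.* c) xs) ≡ sumℤ (List.map f xs) ℤ.* c
sumℤ-map-* f c []       = refl
sumℤ-map-* f c (x ∷ xs) =
  trans (cong (λ s → f x ℤ.* c ℤ.+ s) (sumℤ-map-* f c xs)) (sym (ℤ.*-distribʳ-+ c (f x) _))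

∑-cong : ∀ {n} {H H′ : F₂^ n → ℤ} → (∀ x → H x ≡ H′ x) → ∑ n H ≡ ∑ n H′
∑-cong {n} eq = cong sumℤ (List.map-cong eq (cube n))

∑-suc : ∀ n (H : F₂^ (suc n) → ℤ) →
        ∑ (suc n) H ≡ ∑ n (H ∘ (false ∷_)) ℤ.+ ∑ n (H ∘ (true ∷_))
∑-suc n H = begin
  sumℤ (List.map H (C₀ ++ C₁))
    ≡⟨ cong sumℤ (List.map-++ H C₀ C₁) ⟩
  sumℤ (List.map H C₀ ++ List.map H C₁)
    ≡⟨ sumℤ-++ (List.map H C₀) _ ⟩
  sumℤ (List.map H C₀) ℤ.+ sumℤ (List.map H C₁)
    ≡⟨ cong₂ ℤ._+_ (map-map (false ∷_)) (map-map (true ∷_)) ⟨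
  ∑ n (H ∘ (false ∷_)) ℤ.+ ∑ n (H ∘ (true ∷_)) ∎
  where
  C₀ C₁ : List (F₂^ (suc n))
  C₀ = List.map (false ∷_) (cube n)
  C₁ = List.map (true ∷_) (cube n)
  map-map : ∀ f → ∑ n (H ∘ f) ≡ sumℤ (List.map H (List.map f (cube n)))
  map-map f = cong sumℤ (List.map-∘ (cube n))

cube-unique : ∀ n → Unique (cube n)
cube-unique zero    = [] ∷ []
cube-unique (suc n) = Unique.++⁺ (Unique.map⁺ (cong Vec.tail) (cube-unique n))
                                 (Unique.map⁺ (cong Vec.tail) (cube-unique n))
                                 λ (x∈₀ , x∈₁) →
                                   false≢true (∈-map⁻ _ x∈₀) (∈-map⁻ _ x∈₁)
  where
  false≢true : ∀ {x : F₂^ (suc n)} → ∃ (λ y → y ∈ cube n × x ≡ false ∷ y) →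
               ∃ (λ y → y ∈ cube n × x ≡ true ∷ y) → ⊥
  false≢true (_ , _ , refl) (_ , _ , ())

∈-cube : ∀ {n} (x : F₂^ n) → x ∈ cube n
∈-cube []          = here refl
∈-cube (false ∷ x) = ∈-++⁺ˡ (∈-map⁺ (false ∷_) (∈-cube x))
∈-cube (true ∷ x)  = ∈-++⁺ʳ (List.map (false ∷_) (cube _)) (∈-map⁺ (true ∷_) (∈-cube x))

unique-⊆-length⇒↭ : {A : Set} (xs ys : List A) → Unique xs → (∀ {z} → z ∈ xs → z ∈ ys) →
                    length xs ≡ length ys → xs ↭ ys
unique-⊆-length⇒↭ []       []       _ _ _ = refl
unique-⊆-length⇒↭ (x ∷ xs) ys (x∉xs ∷ xs!) xs⊆ys len with ∈-∃++ (xs⊆ys (here refl))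
... | as , bs , refl =
  ↭-trans (prep x (unique-⊆-length⇒↭ xs (as ++ bs) xs! xs⊆as++bs len′))
          (↭-sym (↭.shift x as bs))
  where
  xs⊆as++bs : ∀ {z} → z ∈ xs → z ∈ as ++ bs
  xs⊆as++bs {z} z∈xs with ∈-++⁻ as (xs⊆ys (there z∈xs))
  ... | inj₁ z∈as         = ∈-++⁺ˡ z∈as
  ... | inj₂ (here refl)  = ⊥-elim (All.lookup x∉xs z∈xs refl)
  ... | inj₂ (there z∈bs) = ∈-++⁺ʳ as z∈bs
  len′ : length xs ≡ length (as ++ bs)
  len′ = ℕ.suc-injective (trans len (↭.↭-length (↭.shift x as bs)))

∑-reindex : ∀ {m n} → m ≡ n → (φ : F₂^ m → F₂^ n) → (∀ {x y} → φ x ≡ φ y → x ≡ y) →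
            (H : F₂^ n → ℤ) → ∑ m (H ∘ φ) ≡ ∑ n H
∑-reindex {n = n} refl φ φ-injective H =
  trans (cong sumℤ (List.map-∘ (cube n))) (sumℤ-↭ (↭.map⁺ H φ[cube]↭cube))
  where
  φ[cube]↭cube : List.map φ (cube n) ↭ cube n
  φ[cube]↭cube = unique-⊆-length⇒↭ _ _ (Unique.map⁺ φ-injective (cube-unique n))
    (λ {z} _ → ∈-cube z) (List.length-map φ (cube n))

∑-lincomb-++ : ∀ {n} (P W : List (F₂^ n)) (H : F₂^ n → ℤ) →
  ∑ (length (P ++ W)) (H ∘ lincomb (P ++ W))
  ≡ ∑ (length P) (λ b → ∑ (length W) (λ c → H (lincomb P b ⊕ lincomb W c)))
∑-lincomb-++ [] W H = begin
  ∑ (length W) (H ∘ lincomb W)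
    ≡⟨ ∑-cong {length W} (λ c → cong H (sym (⊕-identityˡ _))) ⟩
  ∑ (length W) (λ c → H (𝟎 ⊕ lincomb W c))
    ≡⟨ sym (ℤ.+-identityʳ _) ⟩
  ∑ 0 (λ b → ∑ (length W) (λ c → H (lincomb [] b ⊕ lincomb W c))) ∎
∑-lincomb-++ (p ∷ P) W H = begin
  ∑ (suc (length (P ++ W))) (H ∘ lincomb (p ∷ P ++ W))
    ≡⟨ ∑-suc _ (H ∘ lincomb (p ∷ P ++ W)) ⟩
  ∑ (length (P ++ W)) (H ∘ lincomb (P ++ W)) ℤ.+ ∑ (length (P ++ W)) (H ∘ (p ⊕_) ∘ lincomb (P ++ W))
    ≡⟨ cong₂ ℤ._+_ (∑-lincomb-++ P W H) (∑-lincomb-++ P W (H ∘ (p ⊕_))) ⟩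
  ∑ (length P) (inner H P) ℤ.+ ∑ (length P) (inner (H ∘ (p ⊕_)) P)
    ≡⟨ cong (λ s → ∑ (length P) (inner H P) ℤ.+ s) (∑-cong {length P} λ b →
         ∑-cong {length W} λ c → cong H (sym (⊕-assoc p _ _))) ⟩
  ∑ (length P) (inner H P) ℤ.+ ∑ (length P) (inner H (p ∷ P) ∘ (true ∷_))
    ≡⟨ sym (∑-suc (length P) (inner H (p ∷ P))) ⟩
  ∑ (suc (length P)) (inner H (p ∷ P)) ∎
  where
  inner : (F₂^ _ → ℤ) → (Q : List (F₂^ _)) → F₂^ (length Q) → ℤ
  inner H′ Q b = ∑ (length W) (λ c → H′ (lincomb Q b ⊕ lincomb W c))

-- Averages over F₂ᵐ

-- S / 2ᵐ ≤ e; a ℚᵘ denominator is stored as its predecessor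
infix 4 _/2^_≤_ ∣_∣/2^_≤_

_/2^_≤_ : ℤ → ℕ → ℚᵘ.ℚᵘ → Set
S /2^ m ≤ e = ℚᵘ.mkℚᵘ S (2 ^ m ∸ 1) ℚᵘ.≤ e

∣_∣/2^_≤_ : ℤ → ℕ → ℚᵘ.ℚᵘ → Set
∣ S ∣/2^ m ≤ e = (S /2^ m ≤ e) × ((ℤ.- S) /2^ m ≤ e)

suc-pred-2^ : ∀ m → suc (2 ^ m ∸ 1) ≡ 2 ^ m
suc-pred-2^ m = ℕ.suc-pred (2 ^ m) {{ℕ.m^n≢0 2 m}}

/2^-+ : ∀ {S₁ S₂ m e} → S₁ /2^ m ≤ e → S₂ /2^ m ≤ e → (S₁ ℤ.+ S₂) /2^ suc m ≤ e
/2^-+ {S₁} {S₂} {m} {ℚᵘ.mkℚᵘ a b} (ℚᵘ.*≤* le₁) (ℚᵘ.*≤* le₂) = ℚᵘ.*≤*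
  (ℤ.≤-trans (ℤ.≤-reflexive (ℤ.*-distribʳ-+ (ℤ.+ suc b) S₁ S₂))
  (ℤ.≤-trans (ℤ.+-mono-≤ le₁ le₂) (ℤ.≤-reflexive (begin
    a ℤ.* ℤ.+ d ℤ.+ a ℤ.* ℤ.+ d    ≡⟨ sym (ℤ.*-distribˡ-+ a (ℤ.+ d) (ℤ.+ d)) ⟩
    a ℤ.* (ℤ.+ d ℤ.+ ℤ.+ d)        ≡⟨ cong (a ℤ.*_) (sym (ℤ.pos-+ d d)) ⟩
    a ℤ.* ℤ.+ (d + d)              ≡⟨ cong (λ z → a ℤ.* ℤ.+ z) d+d≡2d ⟩
    a ℤ.* ℤ.+ suc (2 ^ suc m ∸ 1)  ∎))))
  where
  d : ℕ
  d = suc (2 ^ m ∸ 1)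
  d+d≡2d : d + d ≡ suc (2 ^ suc m ∸ 1)
  d+d≡2d = begin
    d + d                ≡⟨ cong (λ z → z + z) (suc-pred-2^ m) ⟩
    2 ^ m + 2 ^ m        ≡⟨ cong (2 ^ m +_) (sym (ℕ.+-identityʳ (2 ^ m))) ⟩
    2 ^ suc m            ≡⟨ sym (suc-pred-2^ (suc m)) ⟩
    suc (2 ^ suc m ∸ 1)  ∎

∑-/2^ : ∀ {e} p m (H : F₂^ p → ℤ) → (∀ b → H b /2^ m ≤ e) → ∑ p H /2^ (p + m) ≤ e
∑-/2^ zero    m H H≤ = subst (_/2^ m ≤ _) (sym (ℤ.+-identityʳ (H []))) (H≤ [])
∑-/2^ (suc p) m H H≤ = subst (_/2^ suc (p + m) ≤ _) (sym (∑-suc p H))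
  (/2^-+ {m = p + m} (∑-/2^ p m (H ∘ (false ∷_)) (H≤ ∘ (false ∷_)))
                     (∑-/2^ p m (H ∘ (true ∷_)) (H≤ ∘ (true ∷_))))

∣∣/2^⇒*sign/2^ : ∀ {S m e} → ∣ S ∣/2^ m ≤ e → ∀ b → (S ℤ.* sign b) /2^ m ≤ e
∣∣/2^⇒*sign/2^ {S} {m} (≤ , _)  false = subst (_/2^ m ≤ _) (sym (ℤ.*-identityʳ S)) ≤
∣∣/2^⇒*sign/2^ {S} {m} (_ , -≤) true  =
  subst (_/2^ m ≤ _) (trans (sym (ℤ.-1*i≡-i S)) (ℤ.*-comm ℤ.-1ℤ S)) -≤

/-toℚᵘ : ∀ S m → ℚ.toℚᵘ (_/_ S (2 ^ m) {{ℕ.m^n≢0 2 m}}) ℚᵘ.≃ ℚᵘ.mkℚᵘ S (2 ^ m ∸ 1)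
/-toℚᵘ S m = ℚᵘ.≃-trans (ℚ.toℚᵘ-cong (ℚ./-cong {p₁ = S} refl (sym (suc-pred-2^ m))))
                        (ℚ.toℚᵘ-fromℚᵘ (ℚᵘ.mkℚᵘ S (2 ^ m ∸ 1)))
  where instance _ = ℕ.m^n≢0 2 m

/2^⇒/≤ : ∀ {ε : ℚ} S m → S /2^ m ≤ ℚ.toℚᵘ ε → _/_ S (2 ^ m) {{ℕ.m^n≢0 2 m}} ℚ.≤ ε
/2^⇒/≤ S m ≤ε = ℚ.toℚᵘ-cancel-≤ (ℚᵘ.≤-respˡ-≃ (ℚᵘ.≃-sym (/-toℚᵘ S m)) ≤ε)

∣/∣≤⇒∣∣/2^ : ∀ {ε : ℚ} S m → ℚ.∣ _/_ S (2 ^ m) {{ℕ.m^n≢0 2 m}} ∣ ℚ.≤ ε →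
             ∣ S ∣/2^ m ≤ ℚ.toℚᵘ ε
∣/∣≤⇒∣∣/2^ {ε} S m ∣S/2^m∣≤ε = ℚᵘ.≤-trans (≤∣∣ S) ∣S∣≤ , ℚᵘ.≤-trans -≤∣∣ ∣S∣≤
  where
  instance _ = ℕ.m^n≢0 2 m
  ∣S∣≤ : ℚᵘ.mkℚᵘ (ℤ.+ ℤ.∣ S ∣) (2 ^ m ∸ 1) ℚᵘ.≤ ℚ.toℚᵘ ε
  ∣S∣≤ = ℚᵘ.≤-respˡ-≃
    (ℚᵘ.≃-trans (ℚ.toℚᵘ-homo-∣-∣ (S / 2 ^ m)) (ℚᵘ.∣-∣-cong (/-toℚᵘ S m)))
    (ℚ.toℚᵘ-mono-≤ ∣S/2^m∣≤ε)
  i≤∣i∣ : ∀ i → i ℤ.≤ ℤ.+ ℤ.∣ i ∣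
  i≤∣i∣ (ℤ.+ n)    = ℤ.≤-refl
  i≤∣i∣ ℤ.-[1+ n ] = ℤ.-≤+
  ≤∣∣ : ∀ S → ℚᵘ.mkℚᵘ S (2 ^ m ∸ 1) ℚᵘ.≤ ℚᵘ.mkℚᵘ (ℤ.+ ℤ.∣ S ∣) (2 ^ m ∸ 1)
  ≤∣∣ S = ℚᵘ.*≤* (ℤ.*-monoʳ-≤-nonNeg (ℤ.+ suc (2 ^ m ∸ 1)) (i≤∣i∣ S))
  -≤∣∣ : ℚᵘ.mkℚᵘ (ℤ.- S) (2 ^ m ∸ 1) ℚᵘ.≤ ℚᵘ.mkℚᵘ (ℤ.+ ℤ.∣ S ∣) (2 ^ m ∸ 1)
  -≤∣∣ = subst (λ z → ℚᵘ.mkℚᵘ (ℤ.- S) _ ℚᵘ.≤ ℚᵘ.mkℚᵘ (ℤ.+ z) _)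
               (ℤ.∣-i∣≡∣i∣ S) (≤∣∣ (ℤ.- S))

-- Bases and independence

Independent-∷ : ∀ {n} {v} {vs : List (F₂^ n)} → Independent (v ∷ vs) → Independent vs
Independent-∷ ind a eq = cong Vec.tail (ind (false ∷ a) eq)

Independent-++ʳ : ∀ {n} (P : List (F₂^ n)) {W} → Independent (P ++ W) → Independent W
Independent-++ʳ []      ind = ind
Independent-++ʳ (_ ∷ P) ind = Independent-++ʳ P (Independent-∷ ind)

basis : ∀ n → Vec (F₂^ n) n
basis zero    = []
basis (suc n) = (true ∷ 𝟎) ∷ Vec.map (false ∷_) (basis n)

comb-false∷ : ∀ {n} (a : F₂^ n) →
              comb (Vec.map (false ∷_) (basis n)) a ≡ false ∷ comb (basis n) a
comb-false∷ a = comb-map (false ∷_) (λ _ _ → refl) refl (basis _) a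

comb-basis : ∀ {n} (a : F₂^ n) → comb (basis n) a ≡ a
comb-basis []          = refl
comb-basis (true ∷ a)  =
  trans (cong ((true ∷ 𝟎) ⊕_) (comb-false∷ a))
        (cong (true ∷_) (trans (⊕-identityˡ _) (comb-basis a)))
comb-basis (false ∷ a) = trans (comb-false∷ a) (cong (false ∷_) (comb-basis a))

basis-linIndep : ∀ n → LinIndep (basis n)
basis-linIndep n a eq = trans (sym (comb-basis a)) eq

lincomb-toList : ∀ {n k} (vs : Vec (F₂^ n) k) a →
                 lincomb (Vec.toList vs) a ≡ comb vs (Vec.cast (length-toList vs) a)
lincomb-toList []       []          = refl
lincomb-toList (v ∷ vs) (true ∷ a)  = cong (v ⊕_) (lincomb-toList vs a)
lincomb-toList (v ∷ vs) (false ∷ a) = lincomb-toList vs a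

LinIndep⇒Independent : ∀ {n k} {vs : Vec (F₂^ n) k} → LinIndep vs → Independent (Vec.toList vs)
LinIndep⇒Independent {vs = vs} ind a eq = cast≡𝟎 (length-toList vs)
  (ind (Vec.cast (length-toList vs) a) (trans (sym (lincomb-toList vs a)) eq))
  where
  cast≡𝟎 : ∀ {m n} (m≡n : m ≡ n) {a : F₂^ m} → Vec.cast m≡n a ≡ 𝟎 → a ≡ 𝟎
  cast≡𝟎 refl {a} = trans (sym (cast-is-id refl a))

IsAffineExtractor-restrict : ∀ {n k F ε} → IsAffineExtractor n k F ε →
  (c : F₂^ n) (W : List (F₂^ n)) → Independent W →
  IsAffineExtractor (length W) k (λ b → F (c ⊕ lincomb W b)) ε
IsAffineExtractor-restrict {n} {k} {F} {ε} ext c W W-ind u₀ vs vs-ind =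
  subst (λ q → ℚ.∣ q ∣ ℚ.≤ ε) (sym bias≡) (ext (c ⊕ L u₀) (Vec.map L vs) Lvs-ind)
  where
  L : F₂^ (length W) → F₂^ n
  L = lincomb W
  comb-L : ∀ a → comb (Vec.map L vs) a ≡ L (comb vs a)
  comb-L = comb-map L (lincomb-⊕ W) (lincomb-𝟎 W) vs
  Lvs-ind : LinIndep (Vec.map L vs)
  Lvs-ind a eq = vs-ind a (W-ind (comb vs a) (trans (sym (comb-L a)) eq))
  point : ∀ a → c ⊕ L (u₀ ⊕ comb vs a) ≡ (c ⊕ L u₀) ⊕ comb (Vec.map L vs) a
  point a = begin
    c ⊕ L (u₀ ⊕ comb vs a)                 ≡⟨ cong (c ⊕_) (lincomb-⊕ W u₀ (comb vs a)) ⟩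
    c ⊕ (L u₀ ⊕ L (comb vs a))             ≡⟨ sym (⊕-assoc c _ _) ⟩
    (c ⊕ L u₀) ⊕ L (comb vs a)             ≡⟨ cong ((c ⊕ L u₀) ⊕_) (sym (comb-L a)) ⟩
    (c ⊕ L u₀) ⊕ comb (Vec.map L vs) a     ∎
  bias≡ : affineBias (λ b → F (c ⊕ L b)) u₀ vs ≡ affineBias F (c ⊕ L u₀) (Vec.map L vs)
  bias≡ = cong (λ s → _/_ s (2 ^ k) {{ℕ.m^n≢0 2 k}}) (∑-cong {k} (cong (sign ∘ F) ∘ point))

∑-cosets : ∀ {n e} (P W : List (F₂^ n)) → Independent (P ++ W) → length (P ++ W) ≡ n →
           (H : F₂^ n → ℤ) →
           (∀ c → ∑ (length W) (λ b → H (c ⊕ lincomb W b)) /2^ length W ≤ e) →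
           ∑ n H /2^ n ≤ e
∑-cosets {n} P W ind len H coset-bound = subst₂ (_/2^_≤ _) sum≡ (trans (sym (List.length-++ P)) len)
  (∑-/2^ (length P) (length W) _ (coset-bound ∘ lincomb P))
  where
  sum≡ : ∑ (length P) (λ b → ∑ (length W) (λ c → H (lincomb P b ⊕ lincomb W c))) ≡ ∑ n H
  sum≡ = trans (sym (∑-lincomb-++ P W H))
    (∑-reindex len (lincomb (P ++ W)) (λ {a} {b} → lincomb-injective (P ++ W) ind a b) H)

corr : ∀ {n} → (F₂^ n → Bool) → (F₂^ n → Bool) → F₂^ n → ℤ
corr F G x = sign (F x) ℤ.* sign (G x)

-- If G is constant, Cor(F, G) = ± bias of F on all of F₂ᵏ.
constant-corr-bound : ∀ {k ε} (F G : F₂^ k → Bool) → IsAffineExtractor k k F ε →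
                      DegreeBelow 1 G → ∑ k (corr F G) /2^ k ≤ ℚ.toℚᵘ ε
constant-corr-bound {k} F G ext G-const = subst (_/2^ k ≤ _) sum≡
  (∣∣/2^⇒*sign/2^ {m = k} (subst (λ S → ∣ S ∣/2^ k ≤ _) bias-sum≡
    (∣/∣≤⇒∣∣/2^ _ k (ext 𝟎 (basis k) (basis-linIndep k)))) (G 𝟎))
  where
  G≡G𝟎 : ∀ x → G x ≡ G 𝟎
  G≡G𝟎 x = trans (cong G (sym (⊕-identityˡ x)))
                 (xor≡false⇒≡ (G (𝟎 ⊕ x)) (G 𝟎) (G-const [ x ] refl 𝟎))
  bias-sum≡ : ∑ k (λ a → sign (F (𝟎 ⊕ comb (basis k) a))) ≡ ∑ k (sign ∘ F)
  bias-sum≡ = ∑-cong {k} (λ a → cong (sign ∘ F) (trans (⊕-identityˡ _) (comb-basis a)))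
  sum≡ : ∑ k (sign ∘ F) ℤ.* sign (G 𝟎) ≡ ∑ k (corr F G)
  sum≡ = trans (sym (sumℤ-map-* (sign ∘ F) _ (cube k)))
               (∑-cong {k} (λ x → cong (λ b → sign (F x) ℤ.* sign b) (sym (G≡G𝟎 x))))

-- Gaussian elimination of linear functionals

lincomb-↭ : ∀ {n} {vs ws : List (F₂^ n)} → vs ↭ ws → ∀ b →
            Σ[ a ∈ F₂^ (length vs) ] (lincomb vs a ≡ lincomb ws b) × (a ≡ 𝟎 → b ≡ 𝟎)
lincomb-↭ refl b = b , refl , id
lincomb-↭ {vs = x ∷ xs} {_ ∷ ys} (prep _ p) (c ∷ b) with lincomb-↭ p b
... | a , eq , a≡𝟎⇒b≡𝟎 =
  c ∷ a , trans (lincomb-∷ x xs c a) (trans (cong (scale c x ⊕_) eq) (sym (lincomb-∷ x ys c b))) ,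
  λ ca≡𝟎 → cong₂ _∷_ (cong Vec.head ca≡𝟎) (a≡𝟎⇒b≡𝟎 (cong Vec.tail ca≡𝟎))
lincomb-↭ {vs = x ∷ y ∷ xs} {_ ∷ _ ∷ ys} (swap _ _ p) (c₁ ∷ c₂ ∷ b) with lincomb-↭ p b
... | a , eq , a≡𝟎⇒b≡𝟎 = c₂ ∷ c₁ ∷ a , swapped ,
  λ cca≡𝟎 → cong₂ _∷_ (cong (Vec.head ∘ Vec.tail) cca≡𝟎)
              (cong₂ _∷_ (cong Vec.head cca≡𝟎) (a≡𝟎⇒b≡𝟎 (cong (Vec.tail ∘ Vec.tail) cca≡𝟎)))
  where
  swapped : lincomb (x ∷ y ∷ xs) (c₂ ∷ c₁ ∷ a) ≡ lincomb (y ∷ x ∷ ys) (c₁ ∷ c₂ ∷ b)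
  swapped = begin
    lincomb (x ∷ y ∷ xs) (c₂ ∷ c₁ ∷ a)         ≡⟨ lincomb-∷ x (y ∷ xs) c₂ (c₁ ∷ a) ⟩
    scale c₂ x ⊕ lincomb (y ∷ xs) (c₁ ∷ a)     ≡⟨ cong (scale c₂ x ⊕_) (lincomb-∷ y xs c₁ a) ⟩
    scale c₂ x ⊕ (scale c₁ y ⊕ lincomb xs a)   ≡⟨ sym (⊕-assoc _ _ _) ⟩
    (scale c₂ x ⊕ scale c₁ y) ⊕ lincomb xs a   ≡⟨ cong₂ _⊕_ (⊕-comm _ _) eq ⟩
    (scale c₁ y ⊕ scale c₂ x) ⊕ lincomb ys b   ≡⟨ ⊕-assoc _ _ _ ⟩
    scale c₁ y ⊕ (scale c₂ x ⊕ lincomb ys b)   ≡⟨ cong (scale c₁ y ⊕_) (sym (lincomb-∷ x ys c₂ b)) ⟩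
    scale c₁ y ⊕ lincomb (x ∷ ys) (c₂ ∷ b)     ≡⟨ sym (lincomb-∷ y (x ∷ ys) c₁ (c₂ ∷ b)) ⟩
    lincomb (y ∷ x ∷ ys) (c₁ ∷ c₂ ∷ b)         ∎
lincomb-↭ (Perm.trans p q) b with lincomb-↭ q b
... | a′ , eq₂ , z₂ with lincomb-↭ p a′
...   | a , eq₁ , z₁ = a , trans eq₁ eq₂ , z₂ ∘ z₁

Independent-↭ : ∀ {n} {vs ws : List (F₂^ n)} → vs ↭ ws → Independent vs → Independent ws
Independent-↭ p ind b eq =
  let a , eq′ , a≡𝟎⇒b≡𝟎 = lincomb-↭ p b in a≡𝟎⇒b≡𝟎 (ind a (trans eq′ eq))

-- Clearing the ℓ-component of v with the pivot b (where ℓ b = 1).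
reduce : ∀ {n} → F₂^ n → (F₂^ n → Bool) → F₂^ n → F₂^ n
reduce b ℓ v = if ℓ v then v ⊕ b else v

reduce≡ : ∀ {n} (b : F₂^ n) ℓ v → reduce b ℓ v ≡ v ⊕ scale (ℓ v) b
reduce≡ b ℓ v with ℓ v
... | true  = refl
... | false = sym (⊕-identityʳ v)

lincomb-reduce : ∀ {n} (b : F₂^ n) ℓ R xs (a : F₂^ (length (List.map (reduce b ℓ) xs ++ R))) →
  Σ[ a′ ∈ F₂^ (length (xs ++ R)) ] Σ[ t ∈ Bool ]
    (lincomb (List.map (reduce b ℓ) xs ++ R) a ≡ lincomb (xs ++ R) a′ ⊕ scale t b) ×
    (a′ ≡ 𝟎 → (a ≡ 𝟎) × (t ≡ false))
lincomb-reduce b ℓ R []       a = a , false , sym (⊕-identityʳ _) , (λ a≡𝟎 → a≡𝟎 , refl)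
lincomb-reduce b ℓ R (x ∷ xs) (c ∷ a) with lincomb-reduce b ℓ R xs a
... | a′ , t , eq , a′≡𝟎⇒ = c ∷ a′ , (c ∧ ℓ x) xor t , eq′ , ca′≡𝟎⇒
  where
  eq′ : lincomb (reduce b ℓ x ∷ List.map (reduce b ℓ) xs ++ R) (c ∷ a)
      ≡ lincomb (x ∷ xs ++ R) (c ∷ a′) ⊕ scale ((c ∧ ℓ x) xor t) b
  eq′ = begin
    lincomb (reduce b ℓ x ∷ List.map (reduce b ℓ) xs ++ R) (c ∷ a)
      ≡⟨ lincomb-∷ (reduce b ℓ x) (List.map (reduce b ℓ) xs ++ R) c a ⟩
    scale c (reduce b ℓ x) ⊕ lincomb (List.map (reduce b ℓ) xs ++ R) a
      ≡⟨ cong₂ _⊕_ (cong (scale c) (reduce≡ b ℓ x)) eq ⟩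
    scale c (x ⊕ scale (ℓ x) b) ⊕ (lincomb (xs ++ R) a′ ⊕ scale t b)
      ≡⟨ cong (_⊕ _) (trans (scale-⊕ c x _) (cong (scale c x ⊕_) (scale-∧ c (ℓ x) b))) ⟩
    (scale c x ⊕ scale (c ∧ ℓ x) b) ⊕ (lincomb (xs ++ R) a′ ⊕ scale t b)
      ≡⟨ ⊕-interchange _ _ _ _ ⟩
    (scale c x ⊕ lincomb (xs ++ R) a′) ⊕ (scale (c ∧ ℓ x) b ⊕ scale t b)
      ≡⟨ cong₂ _⊕_ (sym (lincomb-∷ x (xs ++ R) c a′)) (sym (scale-xor (c ∧ ℓ x) t b)) ⟩
    lincomb (x ∷ xs ++ R) (c ∷ a′) ⊕ scale ((c ∧ ℓ x) xor t) b ∎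
  ca′≡𝟎⇒ : c ∷ a′ ≡ 𝟎 → (c ∷ a ≡ 𝟎) × ((c ∧ ℓ x) xor t ≡ false)
  ca′≡𝟎⇒ eq₀ with cong Vec.head eq₀ | a′≡𝟎⇒ (cong Vec.tail eq₀)
  ... | refl | a≡𝟎 , refl = cong (false ∷_) a≡𝟎 , refl

Independent-reduce : ∀ {n} (b : F₂^ n) ℓ (xs R : List (F₂^ n)) →
  Independent (b ∷ xs ++ R) → Independent (b ∷ List.map (reduce b ℓ) xs ++ R)
Independent-reduce b ℓ xs R ind (c ∷ a) eq with lincomb-reduce b ℓ R xs a
... | a′ , t , eqₐ , a′≡𝟎⇒ = cong₂ _∷_ c≡false a≡𝟎
  where
  combination≡𝟎 : lincomb (b ∷ xs ++ R) ((c xor t) ∷ a′) ≡ 𝟎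
  combination≡𝟎 = begin
    lincomb (b ∷ xs ++ R) ((c xor t) ∷ a′)          ≡⟨ lincomb-∷ b (xs ++ R) (c xor t) a′ ⟩
    scale (c xor t) b ⊕ lincomb (xs ++ R) a′         ≡⟨ cong (_⊕ lincomb (xs ++ R) a′) (scale-xor c t b) ⟩
    (scale c b ⊕ scale t b) ⊕ lincomb (xs ++ R) a′   ≡⟨ ⊕-assoc _ _ _ ⟩
    scale c b ⊕ (scale t b ⊕ lincomb (xs ++ R) a′)   ≡⟨ cong (scale c b ⊕_) (trans (⊕-comm _ _) (sym eqₐ)) ⟩
    scale c b ⊕ lincomb (List.map (reduce b ℓ) xs ++ R) a
      ≡⟨ sym (lincomb-∷ b (List.map (reduce b ℓ) xs ++ R) c a) ⟩
    lincomb (b ∷ List.map (reduce b ℓ) xs ++ R) (c ∷ a) ≡⟨ eq ⟩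
    𝟎 ∎
  ct∷a′≡𝟎 : (c xor t) ∷ a′ ≡ 𝟎
  ct∷a′≡𝟎 = ind ((c xor t) ∷ a′) combination≡𝟎
  a≡𝟎 : a ≡ 𝟎
  a≡𝟎 = proj₁ (a′≡𝟎⇒ (cong Vec.tail ct∷a′≡𝟎))
  c≡false : c ≡ false
  c≡false = begin
    c                ≡⟨ sym (xor-identityʳ c) ⟩
    c xor false      ≡⟨ cong (c xor_) (sym (proj₂ (a′≡𝟎⇒ (cong Vec.tail ct∷a′≡𝟎)))) ⟩
    c xor t          ≡⟨ cong Vec.head ct∷a′≡𝟎 ⟩
    false            ∎

Additive : ∀ {n} → (F₂^ n → Bool) → Set
Additive ℓ = ∀ u v → ℓ (u ⊕ v) ≡ ℓ u xor ℓ v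

⊕-Closed : ∀ {n} → (F₂^ n → Set) → Set
⊕-Closed P = ∀ x y → P x → P y → P (x ⊕ y)

ℓ-kernel-closed : ∀ {n} {ℓ : F₂^ n → Bool} → Additive ℓ → ⊕-Closed (λ v → ℓ v ≡ false)
ℓ-kernel-closed ℓ-additive x y ℓx ℓy = trans (ℓ-additive x y) (cong₂ _xor_ ℓx ℓy)

record Elimination {n} (U : List (F₂^ n)) : Set₁ where
  field
    kept pivots : List (F₂^ n)
    length≡     : length kept + length pivots ≡ length U
    independent : ∀ R → Independent (U ++ R) → Independent (kept ++ pivots ++ R)
    kept-closed : ∀ (P : F₂^ n → Set) → ⊕-Closed P → All P U → All P kept

open Elimination

no-elimination : ∀ {n} (U : List (F₂^ n)) → Elimination U
no-elimination U = record
  { kept = U ; pivots = [] ; length≡ = ℕ.+-identityʳ _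
  ; independent = λ _ ind → ind ; kept-closed = λ _ _ → id }

find-pivot : ∀ {n} (ℓ : F₂^ n → Bool) (U : List (F₂^ n)) →
             All (λ v → ℓ v ≡ false) U ⊎ Σ[ b ∈ F₂^ n ] b ∈ U × ℓ b ≡ true
find-pivot ℓ [] = inj₁ []
find-pivot ℓ (u ∷ U) with ℓ u in ℓu | find-pivot ℓ U
... | true  | _                    = inj₂ (u , here refl , ℓu)
... | false | inj₁ all             = inj₁ (ℓu ∷ all)
... | false | inj₂ (b , b∈ , ℓb)   = inj₂ (b , there b∈ , ℓb)

eliminate : ∀ {n} (ℓ : F₂^ n → Bool) → Additive ℓ → (U : List (F₂^ n)) →
  Σ[ r ∈ Elimination U ] (length (pivots r) ≤ 1) × All (λ v → ℓ v ≡ false) (kept r)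
eliminate ℓ ℓ-additive U with find-pivot ℓ U
... | inj₁ ℓ≡false      = no-elimination U , z≤n , ℓ≡false
... | inj₂ (b , b∈U , ℓb) with ∈-∃++ b∈U
...   | as , bs , refl  = record
  { kept = List.map (reduce b ℓ) (as ++ bs) ; pivots = [ b ]
  ; length≡ = length≡′ ; independent = independent′ ; kept-closed = kept-closed′ } ,
  ℕ.≤-refl , AllP.map⁺ (All.universal ℓ-reduce (as ++ bs))
  where
  ℓ-reduce : ∀ w → ℓ (reduce b ℓ w) ≡ false
  ℓ-reduce w with ℓ w in ℓw
  ... | true  = trans (ℓ-additive w b) (cong₂ _xor_ ℓw ℓb)
  ... | false = ℓw
  length≡′ : length (List.map (reduce b ℓ) (as ++ bs)) + 1 ≡ length (as ++ b ∷ bs)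
  length≡′ = begin
    length (List.map (reduce b ℓ) (as ++ bs)) + 1  ≡⟨ cong (_+ 1) (List.length-map _ (as ++ bs)) ⟩
    length (as ++ bs) + 1                         ≡⟨ ℕ.+-comm _ 1 ⟩
    suc (length (as ++ bs))                       ≡⟨ sym (↭.↭-length (↭.shift b as bs)) ⟩
    length (as ++ b ∷ bs)                         ∎
  independent′ : ∀ R → Independent ((as ++ b ∷ bs) ++ R) →
                 Independent (List.map (reduce b ℓ) (as ++ bs) ++ b ∷ R)
  independent′ R ind = Independent-↭ (↭-sym (↭.shift b (List.map (reduce b ℓ) (as ++ bs)) R))
    (Independent-reduce b ℓ (as ++ bs) R (Independent-↭ b-to-front ind))
    where
    b-to-front : (as ++ b ∷ bs) ++ R ↭ b ∷ (as ++ bs) ++ R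
    b-to-front = subst₂ (λ xs ys → xs ↭ b ∷ ys) (sym (List.++-assoc as (b ∷ bs) R))
                        (sym (List.++-assoc as bs R)) (↭.shift b as (bs ++ R))
  kept-closed′ : ∀ P → ⊕-Closed P → All P (as ++ b ∷ bs) →
                 All P (List.map (reduce b ℓ) (as ++ bs))
  kept-closed′ P P-closed Pall with AllP.++⁻ as Pall
  ... | Pas , Pb ∷ Pbs = AllP.map⁺ (All.map (λ {w} → P-reduce w) (AllP.++⁺ Pas Pbs))
    where
    P-reduce : ∀ w → P w → P (reduce b ℓ w)
    P-reduce w Pw with ℓ w
    ... | true  = P-closed w b Pw Pb
    ... | false = Pw

_⨾_ : ∀ {n} {U : List (F₂^ n)} (r₁ : Elimination U) → Elimination (kept r₁) → Elimination U
_⨾_ {U = U} r₁ r₂ = record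
  { kept = kept r₂ ; pivots = pivots r₂ ++ pivots r₁ ; length≡ = length≡′
  ; independent = λ R ind →
      subst (λ z → Independent (kept r₂ ++ z)) (sym (List.++-assoc (pivots r₂) _ R))
            (independent r₂ _ (independent r₁ R ind))
  ; kept-closed = λ P P-closed → kept-closed r₂ P P-closed ∘ kept-closed r₁ P P-closed }
  where
  length≡′ : length (kept r₂) + length (pivots r₂ ++ pivots r₁) ≡ length U
  length≡′ = begin
    length (kept r₂) + length (pivots r₂ ++ pivots r₁)
      ≡⟨ cong (length (kept r₂) +_) (List.length-++ (pivots r₂)) ⟩
    length (kept r₂) + (length (pivots r₂) + length (pivots r₁))
      ≡⟨ sym (ℕ.+-assoc (length (kept r₂)) _ _) ⟩
    (length (kept r₂) + length (pivots r₂)) + length (pivots r₁)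
      ≡⟨ cong (_+ length (pivots r₁)) (length≡ r₂) ⟩
    length (kept r₁) + length (pivots r₁)
      ≡⟨ length≡ r₁ ⟩
    length U ∎

eliminateAll : ∀ {n} {X : Set} (ℓ : X → F₂^ n → Bool) (Ts : List X) → All (Additive ∘ ℓ) Ts →
  (U : List (F₂^ n)) →
  Σ[ r ∈ Elimination U ] (length (pivots r) ≤ length Ts) ×
                         All (λ t → All (λ v → ℓ t v ≡ false) (kept r)) Ts
eliminateAll ℓ []       _                       U = no-elimination U , z≤n , []
eliminateAll ℓ (t ∷ Ts) (ℓt-additive ∷ additive) U with eliminate (ℓ t) ℓt-additive U
... | r₁ , #r₁≤1 , ℓt≡false with eliminateAll ℓ Ts additive (kept r₁)
...   | r₂ , #r₂≤#Ts , ℓTs≡false = r₁ ⨾ r₂ , #pivots≤ ,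
  kept-closed r₂ (λ v → ℓ t v ≡ false) (ℓ-kernel-closed ℓt-additive) ℓt≡false ∷ ℓTs≡false
  where
  #pivots≤ : length (pivots r₂ ++ pivots r₁) ≤ suc (length Ts)
  #pivots≤ = ℕ.≤-trans (ℕ.≤-reflexive (List.length-++ (pivots r₂)))
    (ℕ.≤-trans (ℕ.+-mono-≤ #r₂≤#Ts #r₁≤1) (ℕ.≤-reflexive (ℕ.+-comm (length Ts) 1)))

-- Tuples

module _ {A : Set} where

  _⊗_ : List A → List (List A) → List (List A)
  _⊗_ = List.cartesianProductWith _∷_

  length-⊗ : ∀ xs ts → length (xs ⊗ ts) ≡ length xs * length ts
  length-⊗ []       ts = refl
  length-⊗ (x ∷ xs) ts = trans (List.length-++ (List.map (x ∷_) ts))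
    (cong₂ _+_ (List.length-map (x ∷_) ts) (length-⊗ xs ts))

  ∈-⊗⁻ : ∀ xs ts {s} → s ∈ xs ⊗ ts → ∃ λ x → ∃ λ t → x ∈ xs × t ∈ ts × s ≡ x ∷ t
  ∈-⊗⁻ = ∈-cartesianProductWith⁻ _∷_

  tuples : List A → ℕ → List (List A)
  tuples xs zero    = [ [] ]
  tuples xs (suc p) = xs ⊗ tuples xs p

  length-tuples : ∀ xs p → length (tuples xs p) ≡ length xs ^ p
  length-tuples xs zero    = refl
  length-tuples xs (suc p) = trans (length-⊗ xs (tuples xs p)) (cong (length xs *_) (length-tuples xs p))

  ∈-tuples : ∀ {xs} (s : List A) → All (_∈ xs) s → s ∈ tuples xs (length s)
  ∈-tuples []      _          = here refl
  ∈-tuples (x ∷ s) (x∈ ∷ s⊆) = ∈-cartesianProductWith⁺ _∷_ x∈ (∈-tuples s s⊆)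

  ∈-tuples⇒length : ∀ xs p {s} → s ∈ tuples xs p → length s ≡ p
  ∈-tuples⇒length xs zero    (here refl) = refl
  ∈-tuples⇒length xs (suc p) s∈ with ∈-⊗⁻ xs (tuples xs p) s∈
  ... | _ , _ , _ , t∈ , refl = cong suc (∈-tuples⇒length xs p t∈)

  -- the tuples over xs ++ [ y ] in which y occurs
  tuples-with : A → List A → ℕ → List (List A)
  tuples-with y xs zero    = []
  tuples-with y xs (suc p) = List.map (y ∷_) (tuples (xs ++ [ y ]) p) ++ xs ⊗ tuples-with y xs p

  ∈-tuples-with⇒length : ∀ y xs p {s} → s ∈ tuples-with y xs p → length s ≡ p
  ∈-tuples-with⇒length y xs (suc p) s∈ with ∈-++⁻ (List.map (y ∷_) (tuples (xs ++ [ y ]) p)) s∈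
  ... | inj₁ s∈₁ with ∈-map⁻ (y ∷_) s∈₁
  ...   | t , t∈ , refl = cong suc (∈-tuples⇒length _ p t∈)
  ∈-tuples-with⇒length y xs (suc p) s∈ | inj₂ s∈₂ with ∈-⊗⁻ xs _ s∈₂
  ... | _ , _ , _ , t∈ , refl = cong suc (∈-tuples-with⇒length y xs p t∈)

  tuples-snoc-split : ∀ y xs (s : List A) → All (_∈ xs ++ [ y ]) s →
                      All (_∈ xs) s ⊎ s ∈ tuples-with y xs (length s)
  tuples-snoc-split y xs []      [] = inj₁ []
  tuples-snoc-split y xs (x ∷ s) (x∈ ∷ s⊆) with ∈-++⁻ xs x∈
  ... | inj₂ (here refl) = inj₂ (∈-++⁺ˡ (∈-map⁺ (y ∷_) (∈-tuples s s⊆)))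
  ... | inj₁ x∈xs with tuples-snoc-split y xs s s⊆
  ...   | inj₁ s⊆xs = inj₁ (x∈xs ∷ s⊆xs)
  ...   | inj₂ s∈   = inj₂ (∈-++⁺ʳ (List.map (y ∷_) (tuples (xs ++ [ y ]) (length s)))
                                   (∈-cartesianProductWith⁺ _∷_ x∈xs s∈))

  length-tuples-with : ∀ y xs p → length (tuples-with y xs p) + length xs ^ p ≡ suc (length xs) ^ p
  length-tuples-with y xs zero    = refl
  length-tuples-with y xs (suc p) = begin
    length (List.map (y ∷_) T ++ xs ⊗ tuples-with y xs p) + j * j ^ p
      ≡⟨ cong (_+ j * j ^ p) (List.length-++ (List.map (y ∷_) T)) ⟩
    (length (List.map (y ∷_) T) + length (xs ⊗ tuples-with y xs p)) + j * j ^ p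
      ≡⟨ cong₂ (λ a b → (a + b) + j * j ^ p) (List.length-map (y ∷_) T) (length-⊗ xs _) ⟩
    (length T + j * length (tuples-with y xs p)) + j * j ^ p
      ≡⟨ ℕ.+-assoc (length T) _ _ ⟩
    length T + (j * length (tuples-with y xs p) + j * j ^ p)
      ≡⟨ cong (length T +_) (sym (ℕ.*-distribˡ-+ j _ _)) ⟩
    length T + j * (length (tuples-with y xs p) + j ^ p)
      ≡⟨ cong₂ (λ a b → a + j * b) length-T (length-tuples-with y xs p) ⟩
    suc j ^ p + j * suc j ^ p ∎
    where
    j = length xs
    T = tuples (xs ++ [ y ]) p
    length-T : length T ≡ suc j ^ p
    length-T = trans (length-tuples _ p) (cong (_^ p) (trans (List.length-++ xs) (ℕ.+-comm j 1)))

-- Subspaces on which the degree drops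

module Greedy {n : ℕ} (e : ℕ) (G : F₂^ n → Bool) (deg : DegreeBelow (suc (suc e)) G) where

  Vanishes : List (F₂^ n) → Set
  Vanishes vs = ∀ x → ∂⋆ vs G x ≡ false

  length-∷ʳ : ∀ (ws : List (F₂^ n)) x → length (ws ++ [ x ]) ≡ suc (length ws)
  length-∷ʳ ws x = trans (List.length-++ ws) (ℕ.+-comm (length ws) 1)

  ∂⋆-constant : ∀ ws → length ws ≡ suc e → ∀ x → ∂⋆ ws G x ≡ ∂⋆ ws G 𝟎
  ∂⋆-constant ws len x = trans (cong (∂⋆ ws G) (sym (⊕-identityˡ x)))
    (xor≡false⇒≡ _ _ (trans (sym (∂⋆-++ ws [ x ] G 𝟎))
      (deg (ws ++ [ x ]) (trans (length-∷ʳ ws x) (cong suc len)) 𝟎)))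

  -- For |as| = e, the (e+1)-th derivative ∂_as ∂_v G is a constant, linear in v.
  ℓ : List (F₂^ n) → F₂^ n → Bool
  ℓ as v = ∂⋆ (as ++ [ v ]) G 𝟎

  ℓ≡false⇒Vanishes : ∀ as v → length as ≡ e → ℓ as v ≡ false → Vanishes (as ++ [ v ])
  ℓ≡false⇒Vanishes as v len ℓ≡false x =
    trans (∂⋆-constant (as ++ [ v ]) (trans (length-∷ʳ as v) (cong suc len)) x) ℓ≡false

  ∂⋆-∷ʳ : ∀ as v x → ∂⋆ (as ++ [ v ]) G x ≡ ∂⋆ (v ∷ as) G x
  ∂⋆-∷ʳ as v = ∂⋆-↭ (↭-sym (↭.∷↭∷ʳ v as)) G

  ℓ-additive : ∀ as → length as ≡ e → Additive (ℓ as)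
  ℓ-additive as len u u′ = begin
    ∂⋆ (as ++ [ u ⊕ u′ ]) G 𝟎
      ≡⟨ ∂⋆-∷ʳ as (u ⊕ u′) 𝟎 ⟩
    ∂⋆ ((u ⊕ u′) ∷ as) G 𝟎
      ≡⟨ ∂⋆-∷-⊕ u u′ as G 𝟎 ⟩
    ∂⋆ (u ∷ as) G (𝟎 ⊕ u′) xor ∂⋆ (u′ ∷ as) G 𝟎
      ≡⟨ cong (_xor ∂⋆ (u′ ∷ as) G 𝟎) (∂⋆-constant (u ∷ as) (cong suc len) (𝟎 ⊕ u′)) ⟩
    ∂⋆ (u ∷ as) G 𝟎 xor ∂⋆ (u′ ∷ as) G 𝟎
      ≡⟨ sym (cong₂ _xor_ (∂⋆-∷ʳ as u 𝟎) (∂⋆-∷ʳ as u′ 𝟎)) ⟩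
    ℓ as u xor ℓ as u′ ∎

  Vanishes-⊕ : ∀ u u′ vs → Vanishes (u ∷ vs) → Vanishes (u′ ∷ vs) → Vanishes ((u ⊕ u′) ∷ vs)
  Vanishes-⊕ u u′ vs van van′ x =
    trans (∂⋆-∷-⊕ u u′ vs G x) (cong₂ _xor_ (van (x ⊕ u′)) (van′ x))

  Vanishes-𝟎 : ∀ vs → Vanishes (𝟎 ∷ vs)
  Vanishes-𝟎 vs = ∂⋆-false vs (∂ 𝟎 G) (∂-𝟎 G)

  Vanishes-twice : ∀ u vs → Vanishes (u ∷ u ∷ vs)
  Vanishes-twice u vs = ∂⋆-false vs (∂ u (∂ u G)) (∂-∂-same u G)

  Vanishes-↭ : ∀ {vs ws} → vs ↭ ws → Vanishes vs → Vanishes ws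
  Vanishes-↭ p van x = trans (sym (∂⋆-↭ p G x)) (van x)

  DegreeDrops : List (F₂^ n) → Set
  DegreeDrops W = ∀ vs → length vs ≡ suc e → All (_∈ W) vs → Vanishes vs

  DegreeDrops-[] : DegreeDrops []
  DegreeDrops-[] []       ()
  DegreeDrops-[] (_ ∷ _) _ (() ∷ _)

  extract : ∀ W u vs → All (_∈ W ++ [ u ]) vs →
            All (_∈ W) vs ⊎ Σ[ rest ∈ List (F₂^ n) ] (vs ↭ u ∷ rest) × All (_∈ W ++ [ u ]) rest
  extract W u []       []        = inj₁ []
  extract W u (x ∷ vs) (x∈ ∷ vs⊆) with ∈-++⁻ W x∈
  ... | inj₂ (here refl) = inj₂ (vs , refl , vs⊆)
  ... | inj₁ x∈W with extract W u vs vs⊆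
  ...   | inj₁ vs⊆W              = inj₁ (x∈W ∷ vs⊆W)
  ...   | inj₂ (rest , p , rest⊆) =
    inj₂ (x ∷ rest , ↭-trans (prep x p) (swap x u refl) , ∈-++⁺ˡ x∈W ∷ rest⊆)

  -- A tuple with u twice vanishes, so only the tuples with u once constrain u.
  DegreeDrops-∷ʳ : ∀ W u → DegreeDrops W →
    (∀ as → length as ≡ e → All (_∈ W) as → Vanishes (as ++ [ u ])) → DegreeDrops (W ++ [ u ])
  DegreeDrops-∷ʳ W u drops new vs len vs⊆ with extract W u vs vs⊆
  ... | inj₁ vs⊆W = drops vs len vs⊆W
  ... | inj₂ (rest , p , rest⊆) with extract W u rest rest⊆
  ...   | inj₁ rest⊆W =
    Vanishes-↭ (↭-sym (↭-trans p (↭.∷↭∷ʳ u rest))) (new rest len-rest rest⊆W)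
    where
    len-rest : length rest ≡ e
    len-rest = ℕ.suc-injective (trans (sym (↭.↭-length p)) len)
  ...   | inj₂ (rest′ , p′ , _) =
    Vanishes-↭ (↭-sym (↭-trans p (prep u p′))) (Vanishes-twice u rest′)

  data Span (W : List (F₂^ n)) : F₂^ n → Set where
    span-𝟎 : Span W 𝟎
    span-∈ : ∀ {v} → v ∈ W → Span W v
    span-⊕ : ∀ {u v} → Span W u → Span W v → Span W (u ⊕ v)

  Span-∷ : ∀ {W w v} → Span W v → Span (w ∷ W) v
  Span-∷ span-𝟎       = span-𝟎
  Span-∷ (span-∈ v∈)  = span-∈ (there v∈)
  Span-∷ (span-⊕ s t) = span-⊕ (Span-∷ s) (Span-∷ t)

  Span-lincomb : ∀ W b → Span W (lincomb W b)
  Span-lincomb []      []          = span-𝟎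
  Span-lincomb (w ∷ W) (true ∷ b)  = span-⊕ (span-∈ (here refl)) (Span-∷ (Span-lincomb W b))
  Span-lincomb (w ∷ W) (false ∷ b) = Span-∷ (Span-lincomb W b)

  module _ (W : List (F₂^ n)) (drops : DegreeDrops W) where

    -- by multilinearity, one slot at a time: the slots of pre range over Span W, those of post over W
    vanishes-span : ∀ pre post → All (Span W) pre → All (_∈ W) post →
                    length (pre ++ post) ≡ suc e → Vanishes (pre ++ post)
    vanishes-span-∷ : ∀ {p} → Span W p → ∀ pre post → All (Span W) pre → All (_∈ W) post →
                      length (p ∷ pre ++ post) ≡ suc e → Vanishes (p ∷ pre ++ post)
    vanishes-span []        post _          post⊆ len = drops post len post⊆
    vanishes-span (p ∷ pre) post (sp ∷ pre⊆) post⊆ len = vanishes-span-∷ sp pre post pre⊆ post⊆ len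
    vanishes-span-∷ span-𝟎 pre post _ _ _ = Vanishes-𝟎 (pre ++ post)
    vanishes-span-∷ (span-⊕ {u} {v} su sv) pre post pre⊆ post⊆ len =
      Vanishes-⊕ u v (pre ++ post) (vanishes-span-∷ su pre post pre⊆ post⊆ len)
                                   (vanishes-span-∷ sv pre post pre⊆ post⊆ len)
    vanishes-span-∷ {p} (span-∈ p∈) pre post pre⊆ post⊆ len =
      Vanishes-↭ (↭.shift p pre post)
        (vanishes-span pre (p ∷ post) pre⊆ (p∈ ∷ post⊆)
                       (trans (↭.↭-length (↭.shift p pre post)) len))

    DegreeBelow-restrict : ∀ c → DegreeBelow (suc e) (λ b → G (c ⊕ lincomb W b))
    DegreeBelow-restrict c vs len x =
      trans (∂⋆-∘ (λ b → c ⊕ lincomb W b) (lincomb W) affine vs G x)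
      (subst Vanishes (List.++-identityʳ Lvs)
        (vanishes-span Lvs [] (AllP.map⁺ (All.universal (Span-lincomb W) vs)) []
          (trans (cong length (List.++-identityʳ Lvs)) (trans (List.length-map _ vs) len)))
        (c ⊕ lincomb W x))
      where
      Lvs : List (F₂^ n)
      Lvs = List.map (lincomb W) vs
      affine : ∀ y v → c ⊕ lincomb W (y ⊕ v) ≡ (c ⊕ lincomb W y) ⊕ lincomb W v
      affine y v = trans (cong (c ⊕_) (lincomb-⊕ W y v)) (sym (⊕-assoc c _ _))

  -- Choosing the vectors of W one at a time: a new vector must lie in the kernel of ℓ as for
  -- every e-tuple as from W. Those kernels are cut out of an explicit basis by elimination;
  -- at most j^e basis vectors are discarded by the time |W| = j.
  record Stage (j : ℕ) : Set where
    field
      chosen pool discarded : List (F₂^ n)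
      length-chosen   : length chosen ≡ j
      length-total    : length pool + (length discarded + length chosen) ≡ n
      #discarded≤     : length discarded ≤ j ^ e
      independent     : Independent (pool ++ discarded ++ chosen)
      drops           : DegreeDrops chosen
      pool⊆ker        : ∀ as → length as ≡ e → All (_∈ chosen) as →
                        All (λ v → ℓ as v ≡ false) pool

  open Stage

  stage₀ : Stage 0
  stage₀ = record
    { chosen = [] ; pool = kept r ; discarded = pivots r ; length-chosen = refl
    ; length-total = trans (cong (length (kept r) +_) (ℕ.+-identityʳ _))
                           (trans (length≡ r) (length-toList (basis n)))
    ; #discarded≤ = ℕ.≤-trans #pivots≤ (ℕ.≤-reflexive (length-tuples [] e))
    ; independent = independent r [] (subst Independent (sym (List.++-identityʳ basis-list))
                                            (LinIndep⇒Independent {vs = basis n} (basis-linIndep n)))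
    ; drops = DegreeDrops-[]
    ; pool⊆ker = λ as len as⊆[] →
        All.lookup ℓ≡false (subst (λ p → as ∈ tuples [] p) len (∈-tuples as as⊆[]))
    }
    where
    basis-list : List (F₂^ n)
    basis-list = Vec.toList (basis n)
    elimination : Σ[ r ∈ Elimination basis-list ] (length (pivots r) ≤ length (tuples [] e)) ×
                  All (λ as → All (λ v → ℓ as v ≡ false) (kept r)) (tuples [] e)
    elimination = eliminateAll ℓ (tuples [] e)
      (All.tabulate λ {as} as∈ → ℓ-additive as (∈-tuples⇒length [] e as∈)) basis-list
    r : Elimination basis-list
    r = proj₁ elimination
    #pivots≤ : length (pivots r) ≤ length (tuples [] e)
    #pivots≤ = proj₁ (proj₂ elimination)
    ℓ≡false : All (λ as → All (λ v → ℓ as v ≡ false) (kept r)) (tuples [] e)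
    ℓ≡false = proj₂ (proj₂ elimination)

  length-after-elimination : ∀ {j} (s : Stage j) u U₁ → pool s ≡ u ∷ U₁ → (r : Elimination U₁) →
    length (kept r) + (length (pivots r ++ discarded s) + length (chosen s ++ [ u ])) ≡ n
  length-after-elimination s u U₁ pool≡ r = begin
    length (kept r) + (length (pivots r ++ D) + length (W ++ [ u ]))
      ≡⟨ cong₂ (λ a b → length (kept r) + (a + b)) (List.length-++ (pivots r)) (length-∷ʳ W u) ⟩
    length (kept r) + ((length (pivots r) + length D) + suc (length W))
      ≡⟨ rearrange (length (kept r)) (length (pivots r)) (length D) (length W) ⟩
    suc (length (kept r) + length (pivots r)) + (length D + length W)
      ≡⟨ cong (λ a → suc a + (length D + length W)) (length≡ r) ⟩
    length (u ∷ U₁) + (length D + length W)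
      ≡⟨ cong (λ U → length U + (length D + length W)) (sym pool≡) ⟩
    length (pool s) + (length D + length W)
      ≡⟨ length-total s ⟩
    n ∎
    where
    W D : List (F₂^ n)
    W = chosen s
    D = discarded s
    rearrange : ∀ a b c d → a + ((b + c) + suc d) ≡ suc (a + b) + (c + d)
    rearrange = solve-∀

  extend : ∀ {j} (s : Stage j) u U₁ → pool s ≡ u ∷ U₁ → Stage (suc j)
  extend {j} s u U₁ pool≡ = record
    { chosen = W′ ; pool = kept r ; discarded = pivots r ++ discarded s
    ; length-chosen = trans (length-∷ʳ W u) (cong suc (length-chosen s))
    ; length-total = length-after-elimination s u U₁ pool≡ r
    ; #discarded≤ = #discarded≤′ ; independent = independent′
    ; drops = DegreeDrops-∷ʳ W u (drops s) λ as len as⊆ →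
        ℓ≡false⇒Vanishes as u len
          (All.lookup (pool⊆ker s as len as⊆) (subst (u ∈_) (sym pool≡) (here refl)))
    ; pool⊆ker = pool⊆ker′
    }
    where
    W W′ D : List (F₂^ n)
    W  = chosen s
    W′ = W ++ [ u ]
    D  = discarded s
    elimination : Σ[ r ∈ Elimination U₁ ] (length (pivots r) ≤ length (tuples-with u W e)) ×
                  All (λ as → All (λ v → ℓ as v ≡ false) (kept r)) (tuples-with u W e)
    elimination = eliminateAll ℓ (tuples-with u W e)
      (All.tabulate λ {as} as∈ → ℓ-additive as (∈-tuples-with⇒length u W e as∈)) U₁
    r : Elimination U₁
    r = proj₁ elimination
    #discarded≤′ : length (pivots r ++ D) ≤ suc j ^ e
    #discarded≤′ = ℕ.≤-trans (ℕ.≤-reflexive (List.length-++ (pivots r)))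
      (ℕ.≤-trans (ℕ.+-mono-≤ (proj₁ (proj₂ elimination)) (#discarded≤ s))
        (ℕ.≤-reflexive (trans (cong (λ z → length (tuples-with u W e) + z ^ e) (sym (length-chosen s)))
          (trans (length-tuples-with u W e) (cong (λ z → suc z ^ e) (length-chosen s))))))
    u-to-chosen : u ∷ (U₁ ++ D ++ W) ↭ U₁ ++ D ++ W′
    u-to-chosen = subst (u ∷ (U₁ ++ D ++ W) ↭_)
      (trans (List.++-assoc U₁ (D ++ W) [ u ]) (cong (U₁ ++_) (List.++-assoc D W [ u ])))
      (↭.∷↭∷ʳ u (U₁ ++ D ++ W))
    independent′ : Independent (kept r ++ (pivots r ++ D) ++ W′)
    independent′ = subst (λ z → Independent (kept r ++ z)) (sym (List.++-assoc (pivots r) D W′))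
      (independent r (D ++ W′)
        (Independent-↭ u-to-chosen (subst (λ U → Independent (U ++ D ++ W)) pool≡ (independent s))))
    pool⊆ker′ : ∀ as → length as ≡ e → All (_∈ W′) as → All (λ v → ℓ as v ≡ false) (kept r)
    pool⊆ker′ as len as⊆ with tuples-snoc-split u W as as⊆
    ... | inj₁ as⊆W = kept-closed r (λ v → ℓ as v ≡ false) (ℓ-kernel-closed (ℓ-additive as len))
                        (All-tail (subst (All _) pool≡ (pool⊆ker s as len as⊆W)))
      where
      All-tail : ∀ {P : F₂^ n → Set} → All P (u ∷ U₁) → All P U₁
      All-tail (_ ∷ PU₁) = PU₁
    ... | inj₂ as∈ =
      All.lookup (proj₂ (proj₂ elimination)) (subst (λ p → as ∈ tuples-with u W p) len as∈)

  pool-nonempty : ∀ {j m} (s : Stage j) → j < m → m + m ^ e ≤ n → 0 < length (pool s)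
  pool-nonempty {j} {m} s j<m m+m^e≤n = ℕ.n≢0⇒n>0 λ #pool≡0 → ℕ.<-irrefl refl
    (ℕ.<-≤-trans (ℕ.≤-<-trans (n≤m^e+j #pool≡0) (ℕ.+-monoʳ-< (m ^ e) j<m))
                 (ℕ.≤-trans (ℕ.≤-reflexive (ℕ.+-comm (m ^ e) m)) m+m^e≤n))
    where
    n≤m^e+j : length (pool s) ≡ 0 → n ≤ m ^ e + j
    n≤m^e+j #pool≡0 = ℕ.≤-trans
      (ℕ.≤-reflexive (trans (sym (length-total s))
                            (cong (_+ (length (discarded s) + length (chosen s))) #pool≡0)))
      (ℕ.+-mono-≤ (ℕ.≤-trans (#discarded≤ s) (ℕ.^-monoˡ-≤ e (ℕ.<⇒≤ j<m)))
                  (ℕ.≤-reflexive (length-chosen s)))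

  next-stage : ∀ {j m} → Stage j → j < m → m + m ^ e ≤ n → Stage (suc j)
  next-stage s j<m bound with pool s in pool≡ | pool-nonempty s j<m bound
  ... | u ∷ U₁ | _ = extend s u U₁ pool≡

  stage : ∀ m → m + m ^ e ≤ n → ∀ j → j ≤ m → Stage j
  stage m bound zero    _     = stage₀
  stage m bound (suc j) 1+j≤m = next-stage (stage m bound j (ℕ.<⇒≤ 1+j≤m)) 1+j≤m bound

  decomposition : ∀ m → m + m ^ e ≤ n →
    Σ[ P ∈ List (F₂^ n) ] Σ[ W ∈ List (F₂^ n) ]
      Independent (P ++ W) × length (P ++ W) ≡ n × length W ≡ m × DegreeDrops W
  decomposition m bound =
    pool s ++ discarded s , chosen s ,
    subst Independent (sym (List.++-assoc (pool s) _ _)) (independent s) ,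
    trans (cong length (List.++-assoc (pool s) (discarded s) (chosen s)))
          (trans (List.length-++ (pool s)) (trans (cong (length (pool s) +_) (List.length-++ (discarded s)))
                                                  (length-total s))) ,
    length-chosen s , drops s
    where
    s : Stage m
    s = stage m bound m ℕ.≤-refl

-- The correlation bound

basis-splitting : ∀ {n k} → k ≤ n → Σ[ P ∈ List (F₂^ n) ] Σ[ W ∈ List (F₂^ n) ]
  Independent (P ++ W) × length (P ++ W) ≡ n × length W ≡ k
basis-splitting {n} {k} k≤n =
  List.take (n ∸ k) basis-list , List.drop (n ∸ k) basis-list ,
  subst Independent (sym (List.take++drop≡id (n ∸ k) basis-list))
        (LinIndep⇒Independent {vs = basis n} (basis-linIndep n)) ,
  trans (cong length (List.take++drop≡id (n ∸ k) basis-list)) (length-toList (basis n)) ,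
  trans (List.length-drop (n ∸ k) basis-list)
        (trans (cong (_∸ (n ∸ k)) (length-toList (basis n))) (ℕ.m∸[m∸n]≡n k≤n))
  where
  basis-list : List (F₂^ n)
  basis-list = Vec.toList (basis n)

corr-bound : ∀ d {ε} n k (F G : F₂^ n → Bool) → IsAffineExtractor n k F ε →
             DegreeBelow (suc d) G → threshold d k ≤ n → ∑ n (corr F G) /2^ n ≤ ℚ.toℚᵘ ε
corr-bound zero n k F G ext deg k≤n with basis-splitting k≤n
... | P , W , ind , length≡ , refl = ∑-cosets P W ind length≡ (corr F G) λ c →
  constant-corr-bound (λ b → F (c ⊕ lincomb W b)) (λ b → G (c ⊕ lincomb W b))
    (IsAffineExtractor-restrict {F = F} ext c W (Independent-++ʳ P ind))
    (DegreeBelow-∘-affine 1 (λ b → c ⊕ lincomb W b) (lincomb W) (affine c) deg)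
  where
  affine : ∀ c y v → c ⊕ lincomb W (y ⊕ v) ≡ (c ⊕ lincomb W y) ⊕ lincomb W v
  affine c y v = trans (cong (c ⊕_) (lincomb-⊕ W y v)) (sym (⊕-assoc c _ _))
corr-bound (suc e) n k F G ext deg bound with Greedy.decomposition e G deg (threshold e k) bound
... | P , W , ind , length≡ , length-W , drops = ∑-cosets P W ind length≡ (corr F G) λ c →
  corr-bound e (length W) k (λ b → F (c ⊕ lincomb W b)) (λ b → G (c ⊕ lincomb W b))
    (IsAffineExtractor-restrict {F = F} ext c W (Independent-++ʳ P ind))
    (Greedy.DegreeBelow-restrict e G deg W drops c) (ℕ.≤-reflexive (sym length-W))

-- With k = 0 the extractor bounds every single value, so ε ≥ 1.
dimension-0-corr-bound : ∀ {ε} n (F G : F₂^ n → Bool) → IsAffineExtractor n 0 F ε →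
                         ∑ n (corr F G) /2^ n ≤ ℚ.toℚᵘ ε
dimension-0-corr-bound n F G ext =
  subst (∑ n (corr F G) /2^_≤ _) (ℕ.+-identityʳ n) (∑-/2^ n 0 (corr F G) point-bound)
  where
  point-bound : ∀ x → corr F G x /2^ 0 ≤ _
  point-bound x = ∣∣/2^⇒*sign/2^ {m = 0} (subst (λ S → ∣ S ∣/2^ 0 ≤ _) sign-F≡
    (∣/∣≤⇒∣∣/2^ _ 0 (ext x [] λ { [] _ → refl }))) (G x)
    where
    sign-F≡ : sign (F (x ⊕ 𝟎)) ℤ.+ ℤ.+ 0 ≡ sign (F x)
    sign-F≡ = trans (ℤ.+-identityʳ _) (cong (sign ∘ F) (⊕-identityʳ x))


-- From the rational hypothesis Bound (1/8) k n d to natural numbers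

_^ᵘ_ : ℚᵘ.ℚᵘ → ℕ → ℚᵘ.ℚᵘ
p ^ᵘ zero  = ℚᵘ.1ℚᵘ
p ^ᵘ suc M = p ℚᵘ.* (p ^ᵘ M)

toℚᵘ-^ : ∀ q M → ℚ.toℚᵘ (q ^ℚ M) ℚᵘ.≃ ℚ.toℚᵘ q ^ᵘ M
toℚᵘ-^ q zero    = ℚᵘ.≃-refl
toℚᵘ-^ q (suc M) =
  ℚᵘ.≃-trans (ℚ.toℚᵘ-homo-* q (q ^ℚ M)) (ℚᵘ.*-congˡ {ℚ.toℚᵘ q} (toℚᵘ-^ q M))

^ᵘ-cong : ∀ {p q} M → p ℚᵘ.≃ q → p ^ᵘ M ℚᵘ.≃ q ^ᵘ M
^ᵘ-cong zero    p≃q = ℚᵘ.≃-refl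
^ᵘ-cong (suc M) p≃q = ℚᵘ.*-cong p≃q (^ᵘ-cong M p≃q)

integer-^ᵘ : ∀ a M → ℚᵘ.mkℚᵘ (ℤ.+ a) 0 ^ᵘ M ≡ ℚᵘ.mkℚᵘ (ℤ.+ (a ^ M)) 0
integer-^ᵘ a zero    = refl
integer-^ᵘ a (suc M) = trans (cong (ℚᵘ.mkℚᵘ (ℤ.+ a) 0 ℚᵘ.*_) (integer-^ᵘ a M))
                             (cong (λ z → ℚᵘ.mkℚᵘ z 0) (sym (ℤ.pos-* a (a ^ M))))

-- 1/8 is stored as mkℚᵘ 1 7.
1/8-^ᵘ : ∀ M → ℚᵘ.mkℚᵘ (ℤ.+ 1) 7 ^ᵘ M ≡ ℚᵘ.mkℚᵘ (ℤ.+ 1) (8 ^ M ∸ 1)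
1/8-^ᵘ zero    = refl
1/8-^ᵘ (suc M) = trans (cong (ℚᵘ.mkℚᵘ (ℤ.+ 1) 7 ℚᵘ.*_) (1/8-^ᵘ M))
  (cong (λ z → ℚᵘ.mkℚᵘ (ℤ.+ 1) (8 * z ∸ 1)) (ℕ.suc-pred (8 ^ M) {{ℕ.m^n≢0 8 M}}))

toℚᵘ-integer : ∀ a → ℚ.toℚᵘ (ℤ.+ a / 1) ℚᵘ.≃ ℚᵘ.mkℚᵘ (ℤ.+ a) 0
toℚᵘ-integer a = ℚ.toℚᵘ-fromℚᵘ (ℚᵘ.mkℚᵘ (ℤ.+ a) 0)

Bound-1/8⇒ : ∀ k n M → (ℤ.+ k / 1) ^ℚ M ℚ.≤ ((ℤ.+ 1 / 8) ^ℚ M) ℚ.* (ℤ.+ n / 1) →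
             (8 * k) ^ M ≤ n
Bound-1/8⇒ k n M bound =
  from-*≤* (ℚᵘ.≤-respʳ-≃ rhs≃ (ℚᵘ.≤-respˡ-≃ lhs≃ (ℚ.toℚᵘ-mono-≤ bound)))
  where
  lhs≃ : ℚ.toℚᵘ ((ℤ.+ k / 1) ^ℚ M) ℚᵘ.≃ ℚᵘ.mkℚᵘ (ℤ.+ (k ^ M)) 0
  lhs≃ = ℚᵘ.≃-trans (toℚᵘ-^ _ M)
           (ℚᵘ.≃-trans (^ᵘ-cong M (toℚᵘ-integer k)) (ℚᵘ.≃-reflexive (integer-^ᵘ k M)))
  rhs≃ : ℚ.toℚᵘ (((ℤ.+ 1 / 8) ^ℚ M) ℚ.* (ℤ.+ n / 1))
         ℚᵘ.≃ ℚᵘ.mkℚᵘ (ℤ.+ 1) (8 ^ M ∸ 1) ℚᵘ.* ℚᵘ.mkℚᵘ (ℤ.+ n) 0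
  rhs≃ = ℚᵘ.≃-trans (ℚ.toℚᵘ-homo-* ((ℤ.+ 1 / 8) ^ℚ M) (ℤ.+ n / 1))
    (ℚᵘ.*-cong (ℚᵘ.≃-trans (toℚᵘ-^ _ M)
                  (ℚᵘ.≃-trans (^ᵘ-cong M (ℚ.toℚᵘ-fromℚᵘ (ℚᵘ.mkℚᵘ (ℤ.+ 1) 7))) (ℚᵘ.≃-reflexive (1/8-^ᵘ M))))
               (toℚᵘ-integer n))
  from-*≤* : ℚᵘ.mkℚᵘ (ℤ.+ (k ^ M)) 0 ℚᵘ.≤ ℚᵘ.mkℚᵘ (ℤ.+ 1) (8 ^ M ∸ 1) ℚᵘ.* ℚᵘ.mkℚᵘ (ℤ.+ n) 0 →
             (8 * k) ^ M ≤ n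
  from-*≤* (ℚᵘ.*≤* k^M*8^M≤n) = subst₂ _≤_ lhs≡ rhs≡ (ℤ.drop‿+≤+ (subst₂ ℤ._≤_
    (sym (ℤ.pos-* (k ^ M) _))
    (trans (cong (ℤ._* ℤ.+ 1) (sym (ℤ.pos-* 1 n))) (sym (ℤ.pos-* (1 * n) 1)))
    k^M*8^M≤n))
    where
    lhs≡ : k ^ M * suc ((8 ^ M ∸ 1) * 1) ≡ (8 * k) ^ M
    lhs≡ = begin
      k ^ M * suc ((8 ^ M ∸ 1) * 1)  ≡⟨ cong (λ z → k ^ M * suc z) (ℕ.*-identityʳ _) ⟩
      k ^ M * suc (8 ^ M ∸ 1)        ≡⟨ cong (k ^ M *_) (ℕ.suc-pred (8 ^ M) {{ℕ.m^n≢0 8 M}}) ⟩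
      k ^ M * 8 ^ M                  ≡⟨ ℕ.*-comm (k ^ M) (8 ^ M) ⟩
      8 ^ M * k ^ M                  ≡⟨ [m*n]^o≡m^o*n^o 8 k M ⟨
      (8 * k) ^ M                    ∎
    rhs≡ : (1 * n) * 1 ≡ n
    rhs≡ = trans (ℕ.*-identityʳ (1 * n)) (ℕ.*-identityˡ n)

corollary1p3 : Σ ℚ (λ c → (0ℚ ℚ.< c) ×
    (∀ (n k d : ℕ) (ε : ℚ) (f g : F₂^ n → Bool) →
      IsAffineExtractor n k f ε → d ≥ 1 → HasDegree≤ n d g →
      Bound c k n d → Cor f g ℚ.≤ ε))
corollary1p3 = ℤ.+ 1 / 8 , ℚ.*<* (ℤ.+<+ (s≤s z≤n)) , Cor≤ε
  where
  Cor≤ε : ∀ (n k d : ℕ) (ε : ℚ) (f g : F₂^ n → Bool) →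
          IsAffineExtractor n k f ε → d ≥ 1 → HasDegree≤ n d g →
          Bound (ℤ.+ 1 / 8) k n d → Cor f g ℚ.≤ ε
  Cor≤ε n zero    d       ε f g ext _ _ _ = /2^⇒/≤ _ n (dimension-0-corr-bound n f g ext)
  Cor≤ε n (suc k) (suc d) ε f g ext _ g-deg bound =
    /2^⇒/≤ _ n (corr-bound (suc d) n (suc k) f g ext (HasDegree≤⇒DegreeBelow g-deg)
      (ℕ.≤-trans (threshold≤ d (suc k) (s≤s z≤n)) (Bound-1/8⇒ (suc k) n (d !) bound)))
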